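{- Let $A$ and $M_A$ be as in the context and let $\phi\in M_A$. Then $\phi$ is invertible in $(M_A,*)$ if and only if $\phi(I_n)\ne0$ for all $n\ge1$, where $I_n=\{[n]\}$ is the one-block partition of $[n]$.
   Context: $\mathbb K$ is a field of characteristic $0$. Noncrossing partitions (no $a,b$ in one block, $c,d$ in another with $a<c<b<d$) are identified with standard representatives on $[n]$; restrictions $P_{|X}$ are standardized; $\mathrm{NCP}(n)$: noncrossing partitions of $[n]$, $\mathrm{NCP}=\bigcup_{n\ge1}\mathrm{NCP}(n)$; $P\le Q$ means each block of $Q$ is a union of blocks of $P$. $A$ is the free commutative unital algebra on $\mathrm{NCP}$ with the algebra-morphism coproduct $\delta(P)=\sum_{Q\in\mathrm{NCP}(n),\,Q\ge P}Q\otimes P/Q$, where $P/Q=\prod_{\tau\in Q}P_{|\tau}$, and counit $\varepsilon_A(P)=1$ if $P$ has one block, $0$ otherwise. $M_A$ is the monoid of characters (unital algebra morphisms $A\to\mathbb K$) under $\phi*\psi=m_{\mathbb K}\circ(\phi\otimes\psi)\circ\delta$, with unit $\varepsilon_A$. -}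

module Defs where

open import Level using (_⊔_)
open import Data.Bool using (Bool; true; false; _∧_; not; T; if_then_else_)
open import Data.Nat using (ℕ; zero; suc; _≡ᵇ_; _<ᵇ_; _≤ᵇ_)
open import Data.List using (List; []; _∷_; length; map; upTo; foldr; filterᵇ; concatMap)
open import Data.Product using (Σ; _,_; ∃; _×_; proj₁)
open import Relation.Nullary using (¬_; yes; no)
open import Relation.Nullary.Decidable.Core using (T?)
open import Relation.Binary.PropositionalEquality using (_≢_)
open import Algebra.Bundles using (CommutativeRing)

-- Set partitions of [n] = {0,…,n-1} (0-based) are encoded by their
-- label list l of length n: l[i] = least element of the block of i.
-- This is a canonical (standard) representative.

allᵇ : {A : Set} → (A → Bool) → List A → Bool
allᵇ p []       = true
allᵇ p (x ∷ xs) = p x ∧ allᵇ p xs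

at : List ℕ → ℕ → ℕ
at []       _       = 0
at (x ∷ xs) zero    = x
at (x ∷ xs) (suc i) = at xs i

valid : List ℕ → Bool
valid l =
  (1 ≤ᵇ length l)
  ∧ allᵇ (λ i → (at l i ≤ᵇ i) ∧ (at l (at l i) ≡ᵇ at l i)) is
  ∧ allᵇ (λ a → allᵇ (λ c → allᵇ (λ b → allᵇ (λ d →
        not ((a <ᵇ c) ∧ (c <ᵇ b) ∧ (b <ᵇ d)
             ∧ (at l a ≡ᵇ at l b) ∧ (at l c ≡ᵇ at l d)
             ∧ not (at l a ≡ᵇ at l c))) is) is) is) is
  where is = upTo (length l)

NCP : Set
NCP = Σ (List ℕ) (λ l → T (valid l))

seqs : ℕ → ℕ → List (List ℕ)
seqs k zero    = [] ∷ []
seqs k (suc m) = concatMap (λ x → map (x ∷_) (seqs k m)) (upTo k)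

ncpList : ℕ → List (List ℕ)
ncpList n = filterᵇ valid (seqs n n)

coarser : List ℕ → List ℕ → Bool
coarser Q P = allᵇ (λ i → allᵇ (λ j → not (at P i ≡ᵇ at P j) ∨' (at Q i ≡ᵇ at Q j)) is) is
  where
  is = upTo (length P)
  _∨'_ : Bool → Bool → Bool
  true  ∨' _ = true
  false ∨' b = b

blocks : List ℕ → List (List ℕ)
blocks Q = map (λ m → filterᵇ (λ i → at Q i ≡ᵇ m) is) (filterᵇ (λ m → at Q m ≡ᵇ m) is)
  where is = upTo (length Q)

firstIndex : (ℕ → Bool) → List ℕ → ℕ
firstIndex p []       = 0
firstIndex p (x ∷ xs) = if p x then 0 else suc (firstIndex p xs)

-- standardized restriction P_{|X}, for X an increasing list of positions
restrict : List ℕ → List ℕ → List ℕ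
restrict P X = map (λ x → firstIndex (λ y → at P y ≡ᵇ at P x) X) X

oneBlock : List ℕ → Bool
oneBlock l = allᵇ (λ x → x ≡ᵇ 0) l

-- I_n (n ≥ 1) as a label list: here I (suc n) has n+1 elements
I : ℕ → List ℕ
I n = Data.List.replicate n 0

module _ {c ℓ} (K : CommutativeRing c ℓ) where
  open CommutativeRing K

  natMul : ℕ → Carrier
  natMul zero    = 0#
  natMul (suc n) = 1# + natMul n

  IsField : Set (c ⊔ ℓ)
  IsField = (¬ (0# ≈ 1#)) × (∀ x → ¬ (x ≈ 0#) → ∃ λ y → (x * y) ≈ 1#)

  CharZero : Set ℓ
  CharZero = ∀ n → n ≢ 0 → ¬ (natMul n ≈ 0#)

  -- A character of the free commutative algebra A on NCP is the same
  -- as an arbitrary function NCP → K (its values on the generators).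
  Character : Set c
  Character = NCP → Carrier

  -- value of a character on a label list (0# on non-NCP lists; never used there)
  app : Character → List ℕ → Carrier
  app φ l with T? (valid l)
  ... | yes p = φ (l , p)
  ... | no  _ = 0#

  Σ' : List Carrier → Carrier
  Σ' = foldr _+_ 0#

  Π' : List Carrier → Carrier
  Π' = foldr _*_ 1#

  _⋆_ : Character → Character → Character
  (φ ⋆ ψ) (P , _) =
    Σ' (map (λ Q → app φ Q * Π' (map (λ τ → app ψ (restrict P τ)) (blocks Q)))
            (filterᵇ (λ Q → coarser Q P) (ncpList (length P))))

  εA : Character
  εA (P , _) = if oneBlock P then 1# else 0#

  _≈χ_ : Character → Character → Set ℓ
  φ ≈χ ψ = ∀ P → φ P ≈ ψ P

  Invertible : Character → Set (c ⊔ ℓ)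
  Invertible φ = ∃ λ ψ → ((φ ⋆ ψ) ≈χ εA) × ((ψ ⋆ φ) ≈χ εA)

-- The only coarsening of the one-block partition I_n is I_n itself, and its single block restricts I_n to
-- itself, so (φ ✶ ψ)(I_n) = φ(I_n) ψ(I_n): an invertible φ cannot vanish on any I_n.  Conversely, the term
-- Q = I_n of (φ ✶ ψ)(P) is φ(I_n) ψ(P), while every other term evaluates ψ only at restrictions of P to the
-- blocks of some Q ≠ I_n, which are shorter than P.  If φ(I_n) ≠ 0 this determines a right inverse ψ by
-- recursion on n; then ψ(I_n) ≠ 0 too, so ψ has a right inverse ω, and associativity gives φ = ω.
-- Associativity rests on the bijection R ↦ (R restricted to τ)_{τ ∈ Q} between the partitions R with
-- P ≤ R ≤ Q and the families of coarsenings of the restrictions of P to the blocks of Q.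
{-# OPTIONS --safe #-}
module Submission where

open import Defs
open import Level using (Level)
open import Algebra.Bundles using (CommutativeMonoid; CommutativeRing)
open import Data.Bool using (Bool; true; false; _∧_; not; T; if_then_else_)
open import Data.Bool.Properties using (T-≡; T-irrelevant; ∧-conicalˡ; ∧-conicalʳ)
open import Data.Empty using (⊥; ⊥-elim)
open import Data.Nat using (ℕ; zero; suc; pred; _≤_; _<_; z≤n; s≤s; _≡ᵇ_; _≤ᵇ_)
open import Data.Nat.Properties
  using (0≢1+n; ≡ᵇ⇒≡; ≡⇒≡ᵇ; ≤ᵇ⇒≤; ≤⇒≤ᵇ; <ᵇ⇒<; <⇒<ᵇ; suc-injective; ≤-refl; ≤-antisym; ≤-<-trans; <-≤-trans; <-trans;
         <⇒≤; <-irrefl; <-asym; <-cmp; m≤n⇒m<n∨m≡n; n≤0⇒n≡0; <⇒≱; ≮⇒≥; m<1+n⇒m≤n)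
open import Data.List
  using (List; []; _∷_; length; map; foldr; upTo; applyUpTo; filterᵇ; concatMap; zipWith; replicate; _++_)
open import Data.List.Properties
  using (∷-injectiveˡ; ∷-injectiveʳ; length-map; length-upTo; length-replicate; map-∘; map-++; map-cong-local;
         filter-all; filter-none; filter-notAll)
open import Data.List.Membership.Propositional using (_∈_)
open import Data.List.Membership.Propositional.Properties
  using (∈-filter⁺; ∈-filter⁻; ∈-map⁺; ∈-map⁻; ∈-concat⁺′; ∈-concat⁻′; ∈-upTo⁺; ∈-upTo⁻; ∈-applyUpTo⁻)
open import Data.List.Membership.Propositional.Properties.WithK using (unique∧set⇒bag)
open import Data.List.Relation.Binary.BagAndSetEquality using (∼bag⇒↭)
open import Data.List.Relation.Binary.Permutation.Propositional using (↭⇒↭ₛ′)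
import Data.List.Relation.Binary.Permutation.Propositional.Properties as Perm
import Data.List.Relation.Binary.Permutation.Setoid.Properties as PermSetoid
open import Data.List.Relation.Binary.Pointwise using (Pointwise; []; _∷_; Pointwise-length)
open import Data.List.Relation.Unary.All as All using (All; []; _∷_)
import Data.List.Relation.Unary.All.Properties as All
open import Data.List.Relation.Unary.AllPairs using (AllPairs; []; _∷_)
import Data.List.Relation.Unary.AllPairs.Properties as AllPairs
open import Data.List.Relation.Unary.Any as Any using (Any; here; there)
open import Data.List.Relation.Unary.Unique.Propositional using (Unique)
import Data.List.Relation.Unary.Unique.Propositional.Properties as Unique
open import Data.Product using (Σ; _,_; _×_; proj₁; proj₂)
open import Data.Sum using (inj₁; inj₂)
open import Function using (_∘_; id; Equivalence)
open import Function.Bundles using (_⇔_; mk⇔)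
open import Relation.Binary.Definitions using (tri<; tri≈; tri>)
open import Relation.Binary.PropositionalEquality
  using (_≡_; _≢_; refl; sym; trans; cong; cong₂; subst; subst₂; module ≡-Reasoning)
open import Relation.Nullary using (¬_; yes; no)
open import Relation.Nullary.Decidable.Core using (T?)

true⇒T : ∀ {b} → b ≡ true → T b
true⇒T = Equivalence.from T-≡

T⇒true : ∀ {b} → T b → b ≡ true
T⇒true = Equivalence.to T-≡

true≢false : true ≢ false
true≢false ()

false⇒¬T : ∀ {b} → b ≡ false → ¬ T b
false⇒¬T refl ()

∧-true⁺ : ∀ {a b} → a ≡ true → b ≡ true → a ∧ b ≡ true
∧-true⁺ refl refl = refl

≡ᵇ-true⇒≡ : ∀ m n → (m ≡ᵇ n) ≡ true → m ≡ n
≡ᵇ-true⇒≡ m n h = ≡ᵇ⇒≡ m n (true⇒T h)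

≡⇒≡ᵇ-true : ∀ {m n} → m ≡ n → (m ≡ᵇ n) ≡ true
≡⇒≡ᵇ-true {m} {n} e = T⇒true (≡⇒≡ᵇ m n e)

≢⇒≡ᵇ-false : ∀ {m n} → m ≢ n → (m ≡ᵇ n) ≡ false
≢⇒≡ᵇ-false {m} {n} h with m ≡ᵇ n in eq
... | true  = ⊥-elim (h (≡ᵇ-true⇒≡ m n eq))
... | false = refl

≡ᵇ-cong-⇔ : ∀ {a b c d} → (a ≡ b → c ≡ d) → (c ≡ d → a ≡ b) → (a ≡ᵇ b) ≡ (c ≡ᵇ d)
≡ᵇ-cong-⇔ {a} {b} {c} {d} f g with a ≡ᵇ b in e₁ | c ≡ᵇ d in e₂
... | true  | true  = refl
... | false | false = refl
... | true  | false = trans (sym (≡⇒≡ᵇ-true (f (≡ᵇ-true⇒≡ a b e₁)))) e₂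
... | false | true  = trans (sym e₁) (≡⇒≡ᵇ-true (g (≡ᵇ-true⇒≡ c d e₂)))

allᵇ-sound : ∀ {A : Set} (p : A → Bool) xs → allᵇ p xs ≡ true → ∀ x → x ∈ xs → p x ≡ true
allᵇ-sound p (y ∷ ys) h x (here refl) = ∧-conicalˡ _ _ h
allᵇ-sound p (y ∷ ys) h x (there x∈) = allᵇ-sound p ys (∧-conicalʳ (p y) _ h) x x∈

allᵇ-complete : ∀ {A : Set} (p : A → Bool) xs → (∀ x → x ∈ xs → p x ≡ true) → allᵇ p xs ≡ true
allᵇ-complete p []       h = refl
allᵇ-complete p (y ∷ ys) h = ∧-true⁺ (h y (here refl)) (allᵇ-complete p ys (λ x x∈ → h x (there x∈)))

allᵇ-false⇒counterexample : ∀ {A : Set} (p : A → Bool) xs → allᵇ p xs ≡ false →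
                            Σ A λ x → x ∈ xs × p x ≡ false
allᵇ-false⇒counterexample p (y ∷ ys) h with p y in e
... | false = y , here refl , e
... | true with allᵇ-false⇒counterexample p ys h
... | x , x∈ , e′ = x , there x∈ , e′

allᵇ-upTo-sound : ∀ (p : ℕ → Bool) n → allᵇ p (upTo n) ≡ true → ∀ i → i < n → p i ≡ true
allᵇ-upTo-sound p n h i i<n = allᵇ-sound p (upTo n) h i (∈-upTo⁺ i<n)

allᵇ-upTo-complete : ∀ (p : ℕ → Bool) n → (∀ i → i < n → p i ≡ true) → allᵇ p (upTo n) ≡ true
allᵇ-upTo-complete p n h = allᵇ-complete p (upTo n) (λ x x∈ → h x (∈-upTo⁻ x∈))

∈-filterᵇ⁺ : ∀ {A : Set} (p : A → Bool) {x xs} → x ∈ xs → p x ≡ true → x ∈ filterᵇ p xs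
∈-filterᵇ⁺ p x∈ e = ∈-filter⁺ (T? ∘ p) x∈ (true⇒T e)

∈-filterᵇ⁻ : ∀ {A : Set} (p : A → Bool) {x} xs → x ∈ filterᵇ p xs → x ∈ xs × p x ≡ true
∈-filterᵇ⁻ p xs x∈ with ∈-filter⁻ (T? ∘ p) {xs = xs} x∈
... | x∈xs , px = x∈xs , T⇒true px

filterᵇ-unique : ∀ {A : Set} (p : A → Bool) {xs} → Unique xs → Unique (filterᵇ p xs)
filterᵇ-unique p = Unique.filter⁺ (T? ∘ p)

filterᵇ-cong : ∀ {A : Set} (p q : A → Bool) xs → (∀ x → x ∈ xs → p x ≡ q x) → filterᵇ p xs ≡ filterᵇ q xs
filterᵇ-cong p q []       h = refl
filterᵇ-cong p q (x ∷ xs) h rewrite h x (here refl) with q x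
... | true  = cong (x ∷_) (filterᵇ-cong p q xs (λ y y∈ → h y (there y∈)))
... | false = filterᵇ-cong p q xs (λ y y∈ → h y (there y∈))

map-filterᵇ : ∀ {A B : Set} (f : A → B) (q : B → Bool) xs → map f (filterᵇ (q ∘ f) xs) ≡ filterᵇ q (map f xs)
map-filterᵇ f q []       = refl
map-filterᵇ f q (x ∷ xs) with q (f x)
... | true  = cong (f x ∷_) (map-filterᵇ f q xs)
... | false = map-filterᵇ f q xs

filterᵇ-absorb : ∀ {A : Set} (p q : A → Bool) xs → (∀ x → x ∈ xs → p x ≡ true → q x ≡ true) →
                 filterᵇ p (filterᵇ q xs) ≡ filterᵇ p xs
filterᵇ-absorb p q []       h = refl
filterᵇ-absorb p q (x ∷ xs) h with q x in qx
... | true with p x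
...   | true  = cong (x ∷_) (filterᵇ-absorb p q xs (λ y y∈ → h y (there y∈)))
...   | false = filterᵇ-absorb p q xs (λ y y∈ → h y (there y∈))
filterᵇ-absorb p q (x ∷ xs) h | false with p x in px
...   | true  = ⊥-elim (true≢false (trans (sym (h x (here refl) px)) qx))
...   | false = filterᵇ-absorb p q xs (λ y y∈ → h y (there y∈))

at-map : ∀ (f : ℕ → ℕ) xs i → i < length xs → at (map f xs) i ≡ f (at xs i)
at-map f (x ∷ xs) zero    _       = refl
at-map f (x ∷ xs) (suc i) (s≤s h) = at-map f xs i h

at-∈ : ∀ xs i → i < length xs → at xs i ∈ xs
at-∈ (x ∷ xs) zero    _       = here refl
at-∈ (x ∷ xs) (suc i) (s≤s h) = there (at-∈ xs i h)

∈⇒at : ∀ {x} xs → x ∈ xs → Σ ℕ λ i → i < length xs × at xs i ≡ x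
∈⇒at (y ∷ ys) (here refl) = 0 , s≤s z≤n , refl
∈⇒at (y ∷ ys) (there x∈) with ∈⇒at ys x∈
... | i , i< , e = suc i , s≤s i< , e

at-applyUpTo : ∀ f n i → i < n → at (applyUpTo f n) i ≡ f i
at-applyUpTo f (suc n) zero    _       = refl
at-applyUpTo f (suc n) (suc i) (s≤s h) = at-applyUpTo (f ∘ suc) n i h

at-upTo : ∀ n i → i < n → at (upTo n) i ≡ i
at-upTo = at-applyUpTo id

at-ext : ∀ xs ys → length xs ≡ length ys → (∀ i → i < length xs → at xs i ≡ at ys i) → xs ≡ ys
at-ext []       []       _  _ = refl
at-ext (x ∷ xs) (y ∷ ys) eq h =
  cong₂ _∷_ (h 0 (s≤s z≤n)) (at-ext xs ys (suc-injective eq) (λ i i< → h (suc i) (s≤s i<)))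

map-at-upTo : ∀ xs → map (at xs) (upTo (length xs)) ≡ xs
map-at-upTo xs = at-ext _ xs len λ i i< →
  let i<n = subst (i <_) len i< in
  trans (at-map (at xs) (upTo n) i (subst (i <_) (sym (length-upTo n)) i<n)) (cong (at xs) (at-upTo n i i<n))
  where
  n = length xs
  len : length (map (at xs) (upTo n)) ≡ n
  len = trans (length-map (at xs) (upTo n)) (length-upTo n)

All-at : ∀ (P : ℕ → Set) l → (∀ i → i < length l → P (at l i)) → All P l
All-at P []      h = []
All-at P (x ∷ l) h = h 0 (s≤s z≤n) ∷ All-at P l (λ i i< → h (suc i) (s≤s i<))

firstIndex-≤ : ∀ (p : ℕ → Bool) X j → j < length X → p (at X j) ≡ true → firstIndex p X ≤ j
firstIndex-≤ p (x ∷ X) zero _ h with p x | h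
... | true | _ = z≤n
firstIndex-≤ p (x ∷ X) (suc j) (s≤s j<) h with p x
... | true  = z≤n
... | false = s≤s (firstIndex-≤ p X j j< h)

firstIndex-satisfies : ∀ (p : ℕ → Bool) X j → j < length X → p (at X j) ≡ true →
                       firstIndex p X < length X × p (at X (firstIndex p X)) ≡ true
firstIndex-satisfies p (x ∷ X) zero _ h with p x | h
... | true | _ = s≤s z≤n , h
firstIndex-satisfies p (x ∷ X) (suc j) (s≤s j<) h with p x in e
... | true = s≤s z≤n , e
... | false with firstIndex-satisfies p X j j< h
... | k< , pk = s≤s k< , pk

firstIndex-cong : ∀ (p q : ℕ → Bool) X → (∀ x → x ∈ X → p x ≡ q x) → firstIndex p X ≡ firstIndex q X
firstIndex-cong p q []      h = refl
firstIndex-cong p q (x ∷ X) h rewrite h x (here refl) with q x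
... | true  = refl
... | false = cong suc (firstIndex-cong p q X (λ y y∈ → h y (there y∈)))

firstIndex-map : ∀ (p : ℕ → Bool) (f : ℕ → ℕ) X → firstIndex p (map f X) ≡ firstIndex (p ∘ f) X
firstIndex-map p f []      = refl
firstIndex-map p f (x ∷ X) with p (f x)
... | true  = refl
... | false = cong suc (firstIndex-map p f X)

Increasing : List ℕ → Set
Increasing X = ∀ i j → i < j → j < length X → at X i < at X j

AllPairs<⇒Increasing : ∀ X → AllPairs _<_ X → Increasing X
AllPairs<⇒Increasing (x ∷ X) (x< ∷ X<) zero    (suc j) _         (s≤s j<) = All.lookup x< (at-∈ X j j<)
AllPairs<⇒Increasing (x ∷ X) (x< ∷ X<) (suc i) (suc j) (s≤s i<j) (s≤s j<) = AllPairs<⇒Increasing X X< i j i<j j<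

filterᵇ-upTo-increasing : ∀ (p : ℕ → Bool) n → Increasing (filterᵇ p (upTo n))
filterᵇ-upTo-increasing p n =
  AllPairs<⇒Increasing _ (AllPairs.filter⁺ (T? ∘ p) (AllPairs.applyUpTo⁺₁ id n (λ i<j _ → i<j)))

Increasing-≤ : ∀ X → Increasing X → ∀ i j → i ≤ j → j < length X → at X i ≤ at X j
Increasing-≤ X inc i j i≤j j< with m≤n⇒m<n∨m≡n i≤j
... | inj₁ i<j  = <⇒≤ (inc i j i<j j<)
... | inj₂ refl = ≤-refl

Increasing-injective : ∀ X → Increasing X → ∀ i j → i < length X → j < length X → at X i ≡ at X j → i ≡ j
Increasing-injective X inc i j i< j< e with <-cmp i j
... | tri< i<j _ _ = ⊥-elim (<-irrefl e (inc i j i<j j<))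
... | tri≈ _ i≡j _ = i≡j
... | tri> _ _ j<i = ⊥-elim (<-irrefl (sym e) (inc j i j<i i<))

Increasing-<⁻ : ∀ X → Increasing X → ∀ i j → i < length X → j < length X → at X i < at X j → i < j
Increasing-<⁻ X inc i j i< j< lt with <-cmp i j
... | tri< i<j _ _  = i<j
... | tri≈ _ refl _ = ⊥-elim (<-irrefl refl lt)
... | tri> _ _ j<i  = ⊥-elim (<-asym lt (inc j i j<i i<))

indexOf : List ℕ → ℕ → ℕ
indexOf X i = firstIndex (λ y → y ≡ᵇ i) X

indexOf-spec : ∀ X i → i ∈ X → indexOf X i < length X × at X (indexOf X i) ≡ i
indexOf-spec X i i∈ with ∈⇒at X i∈
... | j , j< , e with firstIndex-satisfies (λ y → y ≡ᵇ i) X j j< (≡⇒≡ᵇ-true e)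
... | k< , pk = k< , ≡ᵇ-true⇒≡ _ _ pk

indexOf-at : ∀ X → Increasing X → ∀ j → j < length X → indexOf X (at X j) ≡ j
indexOf-at X inc j j< with indexOf-spec X (at X j) (at-∈ X j j<)
... | k< , e = Increasing-injective X inc _ _ k< j< e

cartesian : ∀ {A : Set} → List (List A) → List (List A)
cartesian []       = [] ∷ []
cartesian (L ∷ Ls) = concatMap (λ x → map (x ∷_) (cartesian Ls)) L

∈-cartesian⁺ : ∀ {A : Set} {t : List A} {Ls} → Pointwise _∈_ t Ls → t ∈ cartesian Ls
∈-cartesian⁺ []            = here refl
∈-cartesian⁺ (x∈L ∷ t∈Ls) = ∈-concat⁺′ (∈-map⁺ _ (∈-cartesian⁺ t∈Ls)) (∈-map⁺ _ x∈L)

∈-cartesian⁻ : ∀ {A : Set} (t : List A) Ls → t ∈ cartesian Ls → Pointwise _∈_ t Ls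
∈-cartesian⁻ []      []       _            = []
∈-cartesian⁻ (_ ∷ _) []       (here ())
∈-cartesian⁻ (_ ∷ _) []       (there ())
∈-cartesian⁻ t       (L ∷ Ls) t∈ with ∈-concat⁻′ (map (λ x → map (x ∷_) (cartesian Ls)) L) t∈
... | vs , t∈vs , vs∈ with ∈-map⁻ _ vs∈
... | x , x∈L , refl with ∈-map⁻ _ t∈vs
... | t′ , t′∈ , refl = x∈L ∷ ∈-cartesian⁻ t′ Ls t′∈

cartesian-unique : ∀ {A : Set} (Ls : List (List A)) → All Unique Ls → Unique (cartesian Ls)
cartesian-unique []       _          = [] ∷ []
cartesian-unique (L ∷ Ls) (uL ∷ uLs) = Unique.concat⁺ (all-unique L) (AllPairs.map⁺ (disjoint L uL))
  where
  prepend = λ x → map (x ∷_) (cartesian Ls)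
  all-unique : ∀ xs → All Unique (map prepend xs)
  all-unique []       = []
  all-unique (x ∷ xs) = Unique.map⁺ ∷-injectiveʳ (cartesian-unique Ls uLs) ∷ all-unique xs
  disjoint : ∀ xs → Unique xs → AllPairs (λ x y → ∀ {v} → ¬ (v ∈ prepend x × v ∈ prepend y)) xs
  disjoint []       _          = []
  disjoint (x ∷ xs) (x∉ ∷ uxs) = All.map apart x∉ ∷ disjoint xs uxs
    where
    apart : ∀ {y} → x ≢ y → ∀ {v} → ¬ (v ∈ prepend x × v ∈ prepend y)
    apart x≢y (v∈x , v∈y) with ∈-map⁻ _ v∈x | ∈-map⁻ _ v∈y
    ... | _ , _ , refl | _ , _ , e = x≢y (∷-injectiveˡ e)

Pointwise-∈-map : ∀ {A B : Set} (f : B → A) (L : B → List A) bs → (∀ b → b ∈ bs → f b ∈ L b) →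
                  Pointwise _∈_ (map f bs) (map L bs)
Pointwise-∈-map f L []       h = []
Pointwise-∈-map f L (b ∷ bs) h = h b (here refl) ∷ Pointwise-∈-map f L bs (λ c c∈ → h c (there c∈))

map-≡⇒pointwise : ∀ {A B : Set} (f g : A → B) xs → map f xs ≡ map g xs → ∀ x → x ∈ xs → f x ≡ g x
map-≡⇒pointwise f g (y ∷ xs) e x (here refl) = ∷-injectiveˡ e
map-≡⇒pointwise f g (y ∷ xs) e x (there x∈)  = map-≡⇒pointwise f g xs (∷-injectiveʳ e) x x∈

zipWith-map : ∀ {a b c} {A : Set a} {B : Set b} {C : Set c} (G : A → B → C) (f : A → B) xs →
              zipWith G xs (map f xs) ≡ map (λ x → G x (f x)) xs
zipWith-map G f []       = refl
zipWith-map G f (x ∷ xs) = cong (G x (f x) ∷_) (zipWith-map G f xs)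

-- An element t of a cartesian product indexed by distinct keys, read as a function of the key.
select : ∀ {A : Set} → A → List ℕ → List A → ℕ → A
select d (r ∷ rs) (x ∷ t) m = if r ≡ᵇ m then x else select d rs t m
select d _        _       m = d

module _ {A : Set} (d : A) (L : ℕ → List A) where

  private
    select-here : ∀ r rs x t → select d (r ∷ rs) (x ∷ t) r ≡ x
    select-here r rs x t rewrite ≡⇒≡ᵇ-true {r} refl = refl

    select-there : ∀ r rs x t m → r ≢ m → select d (r ∷ rs) (x ∷ t) m ≡ select d rs t m
    select-there r rs x t m r≢m rewrite ≢⇒≡ᵇ-false r≢m = refl

  select-∈ : ∀ rs t → Unique rs → Pointwise _∈_ t (map L rs) → ∀ m → m ∈ rs → select d rs t m ∈ L m
  select-∈ (r ∷ rs) (x ∷ t) _          (x∈ ∷ _)  m (here refl) rewrite select-here r rs x t = x∈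
  select-∈ (r ∷ rs) (x ∷ t) (r∉ ∷ urs) (_ ∷ t∈) m (there m∈)
    rewrite select-there r rs x t m (All.lookup r∉ m∈) = select-∈ rs t urs t∈ m m∈

  map-select : ∀ rs t → Unique rs → Pointwise _∈_ t (map L rs) → map (select d rs t) rs ≡ t
  map-select []       []      _          []        = refl
  map-select (r ∷ rs) (x ∷ t) (r∉ ∷ urs) (_ ∷ t∈) = cong₂ _∷_ (select-here r rs x t)
    (trans (map-cong-local (All.tabulate (λ m∈ → select-there r rs x t _ (All.lookup r∉ m∈))))
           (map-select rs t urs t∈))

-- Noncrossing partitions as label lists

Canonical : List ℕ → Set
Canonical l = ∀ i → i < length l → at l i ≤ i × at l (at l i) ≡ at l i

NonCrossing : List ℕ → Set
NonCrossing l = ∀ a c b d → a < c → c < b → b < d → d < length l →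
                at l a ≡ at l b → at l c ≡ at l d → at l a ≡ at l c

IsNCP : List ℕ → Set
IsNCP l = 1 ≤ length l × Canonical l × NonCrossing l

private
  noncrossing-true⇒ : ∀ {x₁ x₂ x₃ x₄ x₅ y} → x₁ ≡ true → x₂ ≡ true → x₃ ≡ true → x₄ ≡ true → x₅ ≡ true →
                      not (x₁ ∧ x₂ ∧ x₃ ∧ x₄ ∧ x₅ ∧ not y) ≡ true → y ≡ true
  noncrossing-true⇒ {y = true} refl refl refl refl refl _ = refl

  noncrossing-true⇐ : ∀ x₁ x₂ x₃ x₄ x₅ y →
                      (x₁ ≡ true → x₂ ≡ true → x₃ ≡ true → x₄ ≡ true → x₅ ≡ true → y ≡ true) →
                      not (x₁ ∧ x₂ ∧ x₃ ∧ x₄ ∧ x₅ ∧ not y) ≡ true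
  noncrossing-true⇐ false _     _     _     _     _     _ = refl
  noncrossing-true⇐ true  false _     _     _     _     _ = refl
  noncrossing-true⇐ true  true  false _     _     _     _ = refl
  noncrossing-true⇐ true  true  true  false _     _     _ = refl
  noncrossing-true⇐ true  true  true  true  false _     _ = refl
  noncrossing-true⇐ true  true  true  true  true  true  _ = refl
  noncrossing-true⇐ true  true  true  true  true  false h = h refl refl refl refl refl

valid⇒IsNCP : ∀ l → T (valid l) → IsNCP l
valid⇒IsNCP l v = ≤ᵇ⇒≤ 1 n (true⇒T (∧-conicalˡ _ _ h)) , canonical , noncrossing
  where
  n = length l
  h = T⇒true v
  h-canonical = ∧-conicalˡ _ _ (∧-conicalʳ (1 ≤ᵇ n) _ h)
  h-noncrossing = ∧-conicalʳ (allᵇ (λ i → (at l i ≤ᵇ i) ∧ (at l (at l i) ≡ᵇ at l i)) (upTo n)) _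
                              (∧-conicalʳ (1 ≤ᵇ n) _ h)
  canonical : Canonical l
  canonical i i< = let q = allᵇ-upTo-sound _ n h-canonical i i< in
    ≤ᵇ⇒≤ _ _ (true⇒T (∧-conicalˡ _ _ q)) , ≡ᵇ-true⇒≡ _ _ (∧-conicalʳ (at l i ≤ᵇ i) _ q)
  noncrossing : NonCrossing l
  noncrossing a c b d a<c c<b b<d d<n e₁ e₂ =
    let b<n = <-trans b<d d<n ; c<n = <-trans c<b b<n ; a<n = <-trans a<c c<n
        q = allᵇ-upTo-sound _ n (allᵇ-upTo-sound _ n (allᵇ-upTo-sound _ n (allᵇ-upTo-sound _ n
              h-noncrossing a a<n) c c<n) b b<n) d d<n
    in ≡ᵇ-true⇒≡ _ _ (noncrossing-true⇒ (T⇒true (<⇒<ᵇ a<c)) (T⇒true (<⇒<ᵇ c<b)) (T⇒true (<⇒<ᵇ b<d))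
                                       (≡⇒≡ᵇ-true e₁) (≡⇒≡ᵇ-true e₂) q)

IsNCP⇒valid : ∀ l → IsNCP l → T (valid l)
IsNCP⇒valid l (1≤n , canonical , noncrossing) =
  true⇒T (∧-true⁺ (T⇒true (≤⇒≤ᵇ 1≤n)) (∧-true⁺ h-canonical h-noncrossing))
  where
  n = length l
  h-canonical = allᵇ-upTo-complete _ n λ i i< →
    ∧-true⁺ (T⇒true (≤⇒≤ᵇ (proj₁ (canonical i i<)))) (≡⇒≡ᵇ-true (proj₂ (canonical i i<)))
  h-noncrossing =
    allᵇ-upTo-complete _ n λ a _ → allᵇ-upTo-complete _ n λ c _ →
    allᵇ-upTo-complete _ n λ b _ → allᵇ-upTo-complete _ n λ d d<n →
    noncrossing-true⇐ _ _ _ _ _ _ λ a<c c<b b<d e₁ e₂ →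
      ≡⇒≡ᵇ-true (noncrossing a c b d (<ᵇ⇒< _ _ (true⇒T a<c)) (<ᵇ⇒< _ _ (true⇒T c<b)) (<ᵇ⇒< _ _ (true⇒T b<d)) d<n
                   (≡ᵇ-true⇒≡ _ _ e₁) (≡ᵇ-true⇒≡ _ _ e₂))

Coarser : List ℕ → List ℕ → Set
Coarser Q P = ∀ i j → i < length P → j < length P → at P i ≡ at P j → at Q i ≡ at Q j

coarser⇒Coarser : ∀ Q P → coarser Q P ≡ true → Coarser Q P
coarser⇒Coarser Q P h i j i< j< e
  with allᵇ-upTo-sound _ (length P) (allᵇ-upTo-sound _ (length P) h i i<) j j<
... | q rewrite ≡⇒≡ᵇ-true e = ≡ᵇ-true⇒≡ _ _ q

Coarser⇒coarser : ∀ Q P → Coarser Q P → coarser Q P ≡ true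
Coarser⇒coarser Q P C with coarser Q P in e
... | true = refl
... | false with allᵇ-false⇒counterexample _ (upTo (length P)) e
... | i , i∈ , e₂ with allᵇ-false⇒counterexample _ (upTo (length P)) e₂
... | j , j∈ , e₃ with at P i ≡ᵇ at P j in e₄
... | false = sym e₃
... | true  = trans (sym e₃) (≡⇒≡ᵇ-true (C i j (∈-upTo⁻ i∈) (∈-upTo⁻ j∈) (≡ᵇ-true⇒≡ _ _ e₄)))

Coarser-trans : ∀ Q R P → length R ≡ length P → Coarser Q R → Coarser R P → Coarser Q P
Coarser-trans Q R P eq Q≥R R≥P i j i< j< e =
  Q≥R i j (subst (i <_) (sym eq) i<) (subst (j <_) (sym eq) j<) (R≥P i j i< j< e)

seqs≡cartesian : ∀ k m → seqs k m ≡ cartesian (replicate m (upTo k))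
seqs≡cartesian k zero    = refl
seqs≡cartesian k (suc m) = cong (λ c → concatMap (λ x → map (x ∷_) c) (upTo k)) (seqs≡cartesian k m)

seqs⁺ : ∀ k l → All (_< k) l → l ∈ seqs k (length l)
seqs⁺ k l l< = subst (l ∈_) (sym (seqs≡cartesian k (length l))) (∈-cartesian⁺ (choices l l<))
  where
  choices : ∀ l → All (_< k) l → Pointwise _∈_ l (replicate (length l) (upTo k))
  choices []      []        = []
  choices (x ∷ l) (x< ∷ l<) = ∈-upTo⁺ x< ∷ choices l l<

seqs⁻ : ∀ k m l → l ∈ seqs k m → length l ≡ m
seqs⁻ k m l l∈ = trans (Pointwise-length (∈-cartesian⁻ l (replicate m (upTo k)) (subst (l ∈_) (seqs≡cartesian k m) l∈)))
                      (length-replicate m)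

seqs-unique : ∀ k m → Unique (seqs k m)
seqs-unique k m = subst Unique (sym (seqs≡cartesian k m)) (cartesian-unique _ (All.replicate⁺ m (Unique.upTo⁺ k)))

∈-ncpList⁺ : ∀ l → T (valid l) → l ∈ ncpList (length l)
∈-ncpList⁺ l v = ∈-filterᵇ⁺ valid (seqs⁺ (length l) l (All-at _ l labels<)) (T⇒true v)
  where
  labels< : ∀ i → i < length l → at l i < length l
  labels< i i< = ≤-<-trans (proj₁ (proj₁ (proj₂ (valid⇒IsNCP l v)) i i<)) i<

∈-ncpList⁻ : ∀ n l → l ∈ ncpList n → length l ≡ n × T (valid l)
∈-ncpList⁻ n l h with ∈-filterᵇ⁻ valid (seqs n n) h
... | l∈ , v = seqs⁻ n n l l∈ , true⇒T v

coarsenings : List ℕ → List (List ℕ)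
coarsenings P = filterᵇ (λ Q → coarser Q P) (ncpList (length P))

∈-coarsenings⁺ : ∀ P Q → length Q ≡ length P → T (valid Q) → Coarser Q P → Q ∈ coarsenings P
∈-coarsenings⁺ P Q eq v C =
  ∈-filterᵇ⁺ (λ Q → coarser Q P) (subst (λ n → Q ∈ ncpList n) eq (∈-ncpList⁺ Q v)) (Coarser⇒coarser Q P C)

∈-coarsenings⁻ : ∀ P Q → Q ∈ coarsenings P → length Q ≡ length P × T (valid Q) × Coarser Q P
∈-coarsenings⁻ P Q h with ∈-filterᵇ⁻ (λ Q → coarser Q P) (ncpList (length P)) h
... | Q∈ , C with ∈-ncpList⁻ (length P) Q Q∈
... | eq , v = eq , v , coarser⇒Coarser Q P C

coarsenings-unique : ∀ P → Unique (coarsenings P)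
coarsenings-unique P = filterᵇ-unique _ (filterᵇ-unique valid (seqs-unique (length P) (length P)))

-- Blocks and restriction

leaders : List ℕ → List ℕ
leaders Q = filterᵇ (λ m → at Q m ≡ᵇ m) (upTo (length Q))

block : List ℕ → ℕ → List ℕ
block Q m = filterᵇ (λ i → at Q i ≡ᵇ m) (upTo (length Q))

∈-block⁺ : ∀ Q m i → i < length Q → at Q i ≡ m → i ∈ block Q m
∈-block⁺ Q m i i< e = ∈-filterᵇ⁺ (λ i → at Q i ≡ᵇ m) (∈-upTo⁺ i<) (≡⇒≡ᵇ-true e)

∈-block⁻ : ∀ Q m i → i ∈ block Q m → i < length Q × at Q i ≡ m
∈-block⁻ Q m i h with ∈-filterᵇ⁻ (λ i → at Q i ≡ᵇ m) (upTo (length Q)) h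
... | i∈ , e = ∈-upTo⁻ i∈ , ≡ᵇ-true⇒≡ _ _ e

∈-leaders⁺ : ∀ Q m → m < length Q → at Q m ≡ m → m ∈ leaders Q
∈-leaders⁺ Q m m< e = ∈-filterᵇ⁺ (λ m → at Q m ≡ᵇ m) (∈-upTo⁺ m<) (≡⇒≡ᵇ-true e)

∈-leaders⁻ : ∀ Q m → m ∈ leaders Q → m < length Q × at Q m ≡ m
∈-leaders⁻ Q m h with ∈-filterᵇ⁻ (λ m → at Q m ≡ᵇ m) (upTo (length Q)) h
... | m∈ , e = ∈-upTo⁻ m∈ , ≡ᵇ-true⇒≡ _ _ e

label-∈-leaders : ∀ Q → Canonical Q → ∀ i → i < length Q → at Q i ∈ leaders Q
label-∈-leaders Q canQ i i< = ∈-leaders⁺ Q (at Q i) (≤-<-trans (proj₁ (canQ i i<)) i<) (proj₂ (canQ i i<))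

block-increasing : ∀ Q m → Increasing (block Q m)
block-increasing Q m = filterᵇ-upTo-increasing _ (length Q)

block-bounded : ∀ Q m → All (_< length Q) (block Q m)
block-bounded Q m = All.tabulate (λ {i} h → proj₁ (∈-block⁻ Q m i h))

at-block : ∀ Q m j → j < length (block Q m) → at (block Q m) j < length Q × at Q (at (block Q m) j) ≡ m
at-block Q m j j< = ∈-block⁻ Q m _ (at-∈ (block Q m) j j<)

block-nonempty : ∀ Q m → m < length Q → at Q m ≡ m → 0 < length (block Q m)
block-nonempty Q m m< e with block Q m | ∈-block⁺ Q m m m< e
... | _ ∷ _ | _ = s≤s z≤n

at-restrict : ∀ P X j → j < length X → at (restrict P X) j ≡ firstIndex (λ y → at P y ≡ᵇ at P (at X j)) X
at-restrict P X = at-map _ X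

length-restrict : ∀ P X → length (restrict P X) ≡ length X
length-restrict P X = length-map _ X

module _ (P X : List ℕ) where
  private
    r : List ℕ
    r = restrict P X

  restrict-label-≤ : ∀ j → j < length X → at r j ≤ j
  restrict-label-≤ j j< =
    subst (_≤ j) (sym (at-restrict P X j j<)) (firstIndex-≤ _ X j j< (≡⇒≡ᵇ-true {at P (at X j)} refl))

  restrict-label-spec : ∀ j → j < length X → at r j < length X × at P (at X (at r j)) ≡ at P (at X j)
  restrict-label-spec j j<
    with firstIndex-satisfies (λ y → at P y ≡ᵇ at P (at X j)) X j j< (≡⇒≡ᵇ-true {at P (at X j)} refl)
  ... | k< , pk rewrite sym (at-restrict P X j j<) = k< , ≡ᵇ-true⇒≡ _ _ pk

  restrict-same-block⁺ : ∀ j j′ → j < length X → j′ < length X →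
                         at P (at X j) ≡ at P (at X j′) → at r j ≡ at r j′
  restrict-same-block⁺ j j′ j< j′< e = trans (at-restrict P X j j<)
    (trans (firstIndex-cong _ _ X (λ y _ → cong (at P y ≡ᵇ_) e)) (sym (at-restrict P X j′ j′<)))

  restrict-same-block⁻ : ∀ j j′ → j < length X → j′ < length X →
                         at r j ≡ at r j′ → at P (at X j) ≡ at P (at X j′)
  restrict-same-block⁻ j j′ j< j′< e = trans (sym (proj₂ (restrict-label-spec j j<)))
    (trans (cong (λ k → at P (at X k)) e) (proj₂ (restrict-label-spec j′ j′<)))

  restrict-canonical : Canonical r
  restrict-canonical j j<′ = restrict-label-≤ j j< ,
    sym (restrict-same-block⁺ j (at r j) j< (proj₁ (restrict-label-spec j j<)) (sym (proj₂ (restrict-label-spec j j<))))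
    where j< = subst (j <_) (length-restrict P X) j<′

  restrict-noncrossing : NonCrossing P → Increasing X → All (_< length P) X → NonCrossing r
  restrict-noncrossing ncP incX X< a c b d a<c c<b b<d d<′ eab ecd = restrict-same-block⁺ a c a< c<
      (ncP (at X a) (at X c) (at X b) (at X d) (incX a c a<c c<) (incX c b c<b b<) (incX b d b<d d<)
           (All.lookup X< (at-∈ X d d<)) (restrict-same-block⁻ a b a< b< eab) (restrict-same-block⁻ c d c< d< ecd))
    where
    d< = subst (d <_) (length-restrict P X) d<′
    b< = <-trans b<d d<
    c< = <-trans c<b b<
    a< = <-trans a<c c<

  restrict-IsNCP : IsNCP P → Increasing X → All (_< length P) X → 1 ≤ length X → IsNCP r
  restrict-IsNCP (_ , _ , ncP) incX X< 1≤ =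
    subst (1 ≤_) (sym (length-restrict P X)) 1≤ , restrict-canonical , restrict-noncrossing ncP incX X<

firstIndex-canonical : ∀ l j → Canonical l → j < length l →
                       firstIndex (λ y → at l y ≡ᵇ at l j) (upTo (length l)) ≡ at l j
firstIndex-canonical l j canL j< = ≤-antisym k≤lj lj≤k
  where
  n = length l
  p = λ y → at l y ≡ᵇ at l j
  lj< = ≤-<-trans (proj₁ (canL j j<)) j<
  in-upTo : ∀ {i} → i < n → i < length (upTo n)
  in-upTo = subst (_ <_) (sym (length-upTo n))
  p-at-upTo : ∀ i → i < n → at l i ≡ at l j → p (at (upTo n) i) ≡ true
  p-at-upTo i i< e = subst (λ z → (at l z ≡ᵇ at l j) ≡ true) (sym (at-upTo n i i<)) (≡⇒≡ᵇ-true e)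
  hit = firstIndex-satisfies p (upTo n) j (in-upTo j<) (p-at-upTo j j< refl)
  k = firstIndex p (upTo n)
  k< = subst (k <_) (length-upTo n) (proj₁ hit)
  lk≡lj : at l k ≡ at l j
  lk≡lj = ≡ᵇ-true⇒≡ _ _ (subst (λ z → (at l z ≡ᵇ at l j) ≡ true) (at-upTo n k k<) (proj₂ hit))
  k≤lj : k ≤ at l j
  k≤lj = firstIndex-≤ p (upTo n) (at l j) (in-upTo lj<) (p-at-upTo (at l j) lj< (proj₂ (canL j j<)))
  lj≤k : at l j ≤ k
  lj≤k = subst (_≤ k) lk≡lj (proj₁ (canL k k<))

restrict-whole : ∀ P → Canonical P → restrict P (upTo (length P)) ≡ P
restrict-whole P canP = at-ext (restrict P U) P len λ j j<′ →
  let j< = subst (j <_) len j<′ in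
  trans (at-restrict P U j (subst (j <_) (sym (length-upTo _)) j<))
    (trans (cong (λ z → firstIndex (λ y → at P y ≡ᵇ at P z) U) (at-upTo _ j j<))
      (firstIndex-canonical P j canP j<))
  where
  U = upTo (length P)
  len : length (restrict P U) ≡ length P
  len = trans (length-restrict P U) (length-upTo _)

restrict-restrict : ∀ P X Y → All (_< length X) Y → restrict (restrict P X) Y ≡ restrict P (map (at X) Y)
restrict-restrict P X Y Y< = at-ext (restrict rX Y) (restrict P XY) len λ k k<′ →
  let k< = subst (k <_) (length-restrict rX Y) k<′
      Yk< = All.lookup Y< (at-∈ Y k k<)
      same-block : ∀ y → y ∈ Y → (at rX y ≡ᵇ at rX (at Y k)) ≡ (at P (at X y) ≡ᵇ at P (at X (at Y k)))
      same-block y y∈ = ≡ᵇ-cong-⇔ (restrict-same-block⁻ P X y (at Y k) (All.lookup Y< y∈) Yk<)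
                                  (restrict-same-block⁺ P X y (at Y k) (All.lookup Y< y∈) Yk<)
  in begin
    at (restrict rX Y) k
  ≡⟨ at-restrict rX Y k k< ⟩
    firstIndex (λ y → at rX y ≡ᵇ at rX (at Y k)) Y
  ≡⟨ firstIndex-cong _ _ Y same-block ⟩
    firstIndex (λ y → at P (at X y) ≡ᵇ at P (at X (at Y k))) Y
  ≡⟨ firstIndex-map (λ y → at P y ≡ᵇ at P (at X (at Y k))) (at X) Y ⟨
    firstIndex (λ y → at P y ≡ᵇ at P (at X (at Y k))) XY
  ≡⟨ cong (λ z → firstIndex (λ y → at P y ≡ᵇ at P z) XY) (at-map (at X) Y k k<) ⟨
    firstIndex (λ y → at P y ≡ᵇ at P (at XY k)) XY
  ≡⟨ at-restrict P XY k (subst (k <_) (sym (length-map (at X) Y)) k<) ⟨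
    at (restrict P XY) k
  ∎
  where
  open ≡-Reasoning
  rX = restrict P X
  XY = map (at X) Y
  len : length (restrict rX Y) ≡ length (restrict P XY)
  len = trans (length-restrict rX Y) (sym (trans (length-restrict P XY) (length-map (at X) Y)))

restrict-Coarser : ∀ R P X → Coarser R P → All (_< length P) X → Coarser (restrict R X) (restrict P X)
restrict-Coarser R P X R≥P X< i j i<′ j<′ e = restrict-same-block⁺ R X i j i< j<
  (R≥P _ _ (All.lookup X< (at-∈ X i i<)) (All.lookup X< (at-∈ X j j<)) (restrict-same-block⁻ P X i j i< j< e))
  where
  i< = subst (i <_) (length-restrict P X) i<′
  j< = subst (j <_) (length-restrict P X) j<′

-- The one-block partition

oneBlock-sound : ∀ l → oneBlock l ≡ true → ∀ i → i < length l → at l i ≡ 0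
oneBlock-sound l h i i< = ≡ᵇ-true⇒≡ _ _ (allᵇ-sound (λ x → x ≡ᵇ 0) l h (at l i) (at-∈ l i i<))

oneBlock-complete : ∀ l → (∀ i → i < length l → at l i ≡ 0) → oneBlock l ≡ true
oneBlock-complete l h = allᵇ-complete _ l λ x x∈ →
  let (i , i< , e) = ∈⇒at l x∈ in ≡⇒≡ᵇ-true (trans (sym e) (h i i<))

at-I : ∀ n i → at (I n) i ≡ 0
at-I zero    i       = refl
at-I (suc n) zero    = refl
at-I (suc n) (suc i) = at-I n i

length-I : ∀ n → length (I n) ≡ n
length-I n = length-replicate n

oneBlock-I : ∀ n → oneBlock (I n) ≡ true
oneBlock-I n = oneBlock-complete (I n) (λ i _ → at-I n i)

oneBlock⇒≡I : ∀ l → oneBlock l ≡ true → l ≡ I (length l)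
oneBlock⇒≡I l h = at-ext l (I (length l)) (sym (length-I _)) λ i i< →
  trans (oneBlock-sound l h i i<) (sym (at-I (length l) i))

IsNCP-I : ∀ m → IsNCP (I (suc m))
IsNCP-I m = s≤s z≤n , canonical , λ a c _ _ _ _ _ _ _ _ → trans (at-I (suc m) a) (sym (at-I (suc m) c))
  where
  canonical : Canonical (I (suc m))
  canonical i _ = subst (_≤ i) (sym (at-I (suc m) i)) z≤n ,
                  trans (cong (at (I (suc m))) (at-I (suc m) i)) (sym (at-I (suc m) i))

valid-I : ∀ m → T (valid (I (suc m)))
valid-I m = IsNCP⇒valid _ (IsNCP-I m)

blocks-I : ∀ m → blocks (I (suc m)) ≡ upTo (suc m) ∷ []
blocks-I m = begin
    map (block Iₙ) (leaders Iₙ)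
  ≡⟨ cong (map (block Iₙ)) leaders-I ⟩
    block Iₙ 0 ∷ []
  ≡⟨ cong (_∷ []) (filter-all (T? ∘ in-block-0) (All.tabulate (λ {x} _ → true⇒T (≡⇒≡ᵇ-true (at-I (suc m) x))))) ⟩
    upTo (length Iₙ) ∷ []
  ≡⟨ cong (λ n → upTo n ∷ []) (length-I (suc m)) ⟩
    upTo (suc m) ∷ []
  ∎
  where
  open ≡-Reasoning
  Iₙ = I (suc m)
  in-block-0 = λ i → at Iₙ i ≡ᵇ 0
  leaders-I : leaders Iₙ ≡ 0 ∷ []
  leaders-I = cong (0 ∷_) (filter-none (T? ∘ (λ k → at Iₙ k ≡ᵇ k)) (All.tabulate not-leader))
    where
    not-leader : ∀ {x} → x ∈ applyUpTo suc (length (I m)) → ¬ T (at Iₙ x ≡ᵇ x)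
    not-leader x∈ with ∈-applyUpTo⁻ suc x∈
    ... | k , _ , refl = false⇒¬T (≢⇒≡ᵇ-false (λ e → 0≢1+n (trans (sym (at-I (suc m) (suc k))) e)))

I∈coarsenings : ∀ P → IsNCP P → I (length P) ∈ coarsenings P
I∈coarsenings (x ∷ P) _ = ∈-coarsenings⁺ (x ∷ P) (I (suc (length P))) (length-I _) (valid-I (length P))
  (λ i j _ _ _ → trans (at-I (suc (length P)) i) (sym (at-I (suc (length P)) j)))

coarsening-oneBlock⇒≡I : ∀ P Q → Q ∈ coarsenings P → oneBlock Q ≡ true → Q ≡ I (length P)
coarsening-oneBlock⇒≡I P Q Q∈ h = trans (oneBlock⇒≡I Q h) (cong I (proj₁ (∈-coarsenings⁻ P Q Q∈)))

coarsening-I-oneBlock : ∀ m Q → Q ∈ coarsenings (I (suc m)) → oneBlock Q ≡ true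
coarsening-I-oneBlock m Q Q∈ with ∈-coarsenings⁻ (I (suc m)) Q Q∈
... | eq , v , Q≥I = oneBlock-complete Q λ i i< →
  let (_ , canQ , _) = valid⇒IsNCP Q v
      0<Q = subst (0 <_) (sym (trans eq (length-I (suc m)))) (s≤s z≤n)
  in trans (Q≥I i 0 (subst (i <_) eq i<) (subst (0 <_) eq 0<Q) (trans (at-I (suc m) i) (sym (at-I (suc m) 0))))
           (n≤0⇒n≡0 (proj₁ (canQ 0 0<Q)))

block-misses-index : ∀ Q m → Canonical Q → 1 ≤ length Q → oneBlock Q ≡ false →
                     Any (λ i → ¬ T (at Q i ≡ᵇ m)) (upTo (length Q))
block-misses-index Q (suc m) canQ 1≤Q _ =
  Any.map (λ { refl → false⇒¬T (≢⇒≡ᵇ-false (λ e → 0≢1+n (trans (sym (n≤0⇒n≡0 (proj₁ (canQ 0 1≤Q)))) e))) })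
          (∈-upTo⁺ 1≤Q)
block-misses-index Q zero canQ 1≤Q notOne with allᵇ-false⇒counterexample (λ x → x ≡ᵇ 0) Q notOne
... | y , y∈ , e with ∈⇒at Q y∈
... | i , i< , refl = Any.map (λ { refl → false⇒¬T e }) (∈-upTo⁺ i<)

block-shorter : ∀ P Q τ → Q ∈ coarsenings P → oneBlock Q ≡ false → τ ∈ blocks Q → length τ < length P
block-shorter P Q τ Q∈ notOne τ∈ with ∈-coarsenings⁻ P Q Q∈ | ∈-map⁻ (block Q) τ∈
... | eq , v , _ | m , _ , refl with valid⇒IsNCP Q v
... | 1≤Q , canQ , _ = subst (length (block Q m) <_) (trans (length-upTo _) eq)
      (filter-notAll (T? ∘ (λ i → at Q i ≡ᵇ m)) (upTo (length Q)) (block-misses-index Q m canQ 1≤Q notOne))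

restrict-block-IsNCP : ∀ P Q m → IsNCP P → length Q ≡ length P → m ∈ leaders Q → IsNCP (restrict P (block Q m))
restrict-block-IsNCP P Q m ncpP eq m∈ with ∈-leaders⁻ Q m m∈
... | m< , e = restrict-IsNCP P (block Q m) ncpP (block-increasing Q m)
                 (All.map (subst (_ <_) eq) (block-bounded Q m)) (block-nonempty Q m m< e)

restrict-own-block-oneBlock : ∀ P m → m ∈ leaders P → oneBlock (restrict P (block P m)) ≡ true
restrict-own-block-oneBlock P m m∈ with ∈-leaders⁻ P m m∈
... | m< , e = oneBlock-complete (restrict P τ) λ j j<′ →
  let j< = subst (j <_) (length-restrict P τ) j<′
      τ≠[] = block-nonempty P m m< e
  in trans (at-restrict P τ j j<) (n≤0⇒n≡0 (firstIndex-≤ _ τ 0 τ≠[]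
       (≡⇒≡ᵇ-true (trans (proj₂ (at-block P m 0 τ≠[])) (sym (proj₂ (at-block P m j j<)))))))
  where τ = block P m

first-difference : ∀ Q P → length Q ≡ length P → Q ≢ P → Σ ℕ λ i → i < length P × at Q i ≢ at P i
first-difference Q P eq Q≢P with allᵇ (λ i → at Q i ≡ᵇ at P i) (upTo (length P)) in e
... | true = ⊥-elim (Q≢P (at-ext Q P eq λ i i< →
               ≡ᵇ-true⇒≡ _ _ (allᵇ-upTo-sound _ (length P) e i (subst (i <_) eq i<))))
... | false with allᵇ-false⇒counterexample (λ i → at Q i ≡ᵇ at P i) (upTo (length P)) e
... | i , i∈ , e′ = i , ∈-upTo⁻ i∈ , λ x → true≢false (trans (sym (≡⇒≡ᵇ-true x)) e′)

strict-coarsening-splits-block : ∀ P Q → IsNCP P → Q ∈ coarsenings P → Q ≢ P →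
                                 Σ ℕ λ m → m ∈ leaders Q × oneBlock (restrict P (block Q m)) ≡ false
strict-coarsening-splits-block P Q ncpP Q∈ Q≢P with ∈-coarsenings⁻ P Q Q∈
... | eq , vQ , Q≥P with valid⇒IsNCP Q vQ | ncpP | first-difference Q P eq Q≢P
... | _ , canQ , _ | _ , canP , _ | i , i< , Qi≢Pi = m , m∈ , not-oneBlock
  where
  i<Q = subst (i <_) (sym eq) i<
  m = at Q i
  m<Q = ≤-<-trans (proj₁ (canQ i i<Q)) i<Q
  m∈ = ∈-leaders⁺ Q m m<Q (proj₂ (canQ i i<Q))
  τ = block Q m
  i∈τ = ∈-block⁺ Q m i i<Q refl
  m∈τ = ∈-block⁺ Q m m m<Q (proj₂ (canQ i i<Q))
  Pm≢Pi : at P m ≢ at P i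
  Pm≢Pi e = Qi≢Pi (≤-antisym Qi≤Pi (subst (_≤ at Q i) e (proj₁ (canP m (subst (m <_) eq m<Q)))))
    where
    Pi< = ≤-<-trans (proj₁ (canP i i<)) i<
    Qi≤Pi : at Q i ≤ at P i
    Qi≤Pi = subst (_≤ at P i) (Q≥P (at P i) i Pi< i< (proj₂ (canP i i<)))
                  (proj₁ (canQ (at P i) (subst (_ <_) (sym eq) Pi<)))
  not-oneBlock : oneBlock (restrict P τ) ≡ false
  not-oneBlock with oneBlock (restrict P τ) in e
  ... | false = refl
  ... | true = ⊥-elim (Pm≢Pi (trans (cong (at P) (sym (proj₂ sm)))
                  (trans (restrict-same-block⁻ P τ (indexOf τ m) (indexOf τ i) (proj₁ sm) (proj₁ si)
                            (trans (label0 (indexOf τ m) (proj₁ sm)) (sym (label0 (indexOf τ i) (proj₁ si)))))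
                         (cong (at P) (proj₂ si)))))
    where
    sm = indexOf-spec τ m m∈τ
    si = indexOf-spec τ i i∈τ
    label0 : ∀ j → j < length τ → at (restrict P τ) j ≡ 0
    label0 j j< = oneBlock-sound (restrict P τ) e j (subst (j <_) (sym (length-restrict P τ)) j<)

-- The interval [P, Q] of partitions between P and a coarsening Q

module BlockOfCoarser (Q R : List ℕ) (eq : length Q ≡ length R) (canR : Canonical R) (Q≥R : Coarser Q R)
                      (m : ℕ) where

  private
    τ r : List ℕ
    τ = block Q m
    r = restrict R τ

    τ< : ∀ j → j < length τ → at τ j < length R
    τ< j j< = subst (_ <_) eq (proj₁ (at-block Q m j j<))

  leader⇒restrict-leader : ∀ j → j < length τ → at R (at τ j) ≡ at τ j → at r j ≡ j
  leader⇒restrict-leader j j< e with <-cmp (at r j) j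
  ... | tri≈ _ rj≡j _ = rj≡j
  ... | tri> _ _ j<rj = ⊥-elim (<⇒≱ j<rj (restrict-label-≤ R τ j j<))
  ... | tri< rj<j _ _ = ⊥-elim (<⇒≱ (block-increasing Q m _ _ rj<j j<) τj≤τk)
    where
    k = at r j
    spec = restrict-label-spec R τ j j<
    τj≤τk : at τ j ≤ at τ k
    τj≤τk = subst (_≤ at τ k) (trans (proj₂ spec) e) (proj₁ (canR (at τ k) (τ< k (proj₁ spec))))

  restrict-leader⇒leader : ∀ j → j < length τ → at r j ≡ j → at R (at τ j) ≡ at τ j
  restrict-leader⇒leader j j< e = trans (sym (proj₂ spec-k)) (cong (at τ) k≡j)
    where
    y = at τ j
    x = at R y
    can-y = canR y (τ< j j<)
    x< = ≤-<-trans (proj₁ can-y) (τ< j j<)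
    x∈τ : x ∈ τ
    x∈τ = ∈-block⁺ Q m x (subst (x <_) (sym eq) x<)
            (trans (Q≥R x y x< (τ< j j<) (proj₂ can-y)) (proj₂ (at-block Q m j j<)))
    k = indexOf τ x
    spec-k = indexOf-spec τ x x∈τ
    rk≡j : at r k ≡ j
    rk≡j = trans (restrict-same-block⁺ R τ k j (proj₁ spec-k) j< (trans (cong (at R) (proj₂ spec-k)) (proj₂ can-y))) e
    k≡j : k ≡ j
    k≡j = ≤-antisym
      (≮⇒≥ (λ j<k → <⇒≱ (block-increasing Q m j k j<k (proj₁ spec-k))
                         (subst (_≤ y) (sym (proj₂ spec-k)) (proj₁ can-y))))
      (subst (_≤ k) rk≡j (restrict-label-≤ R τ k (proj₁ spec-k)))

  map-block-restrict : ∀ j → j < length τ → at R (at τ j) ≡ at τ j → map (at τ) (block r j) ≡ block R (at τ j)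
  map-block-restrict j j< e = begin
      map (at τ) (filterᵇ (λ j′ → at r j′ ≡ᵇ j) (upTo (length r)))
    ≡⟨ cong (λ n → map (at τ) (filterᵇ (λ j′ → at r j′ ≡ᵇ j) (upTo n))) (length-restrict R τ) ⟩
      map (at τ) (filterᵇ (λ j′ → at r j′ ≡ᵇ j) (upTo (length τ)))
    ≡⟨ cong (map (at τ)) (filterᵇ-cong _ _ (upTo (length τ)) same-block) ⟩
      map (at τ) (filterᵇ (in-R-block ∘ at τ) (upTo (length τ)))
    ≡⟨ map-filterᵇ (at τ) in-R-block (upTo (length τ)) ⟩
      filterᵇ in-R-block (map (at τ) (upTo (length τ)))
    ≡⟨ cong (filterᵇ in-R-block) (map-at-upTo τ) ⟩
      filterᵇ in-R-block τ
    ≡⟨ filterᵇ-absorb in-R-block (λ i → at Q i ≡ᵇ m) (upTo (length Q)) R-block⊆τ ⟩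
      filterᵇ in-R-block (upTo (length Q))
    ≡⟨ cong (λ n → filterᵇ in-R-block (upTo n)) eq ⟩
      block R (at τ j)
    ∎
    where
    open ≡-Reasoning
    in-R-block = λ i → at R i ≡ᵇ at τ j
    rj≡j = leader⇒restrict-leader j j< e
    same-block : ∀ j′ → j′ ∈ upTo (length τ) → (at r j′ ≡ᵇ j) ≡ in-R-block (at τ j′)
    same-block j′ j′∈ = let j′< = ∈-upTo⁻ j′∈ in ≡ᵇ-cong-⇔
      (λ x → trans (restrict-same-block⁻ R τ j′ j j′< j< (trans x (sym rj≡j))) e)
      (λ x → trans (restrict-same-block⁺ R τ j′ j j′< j< (trans x (sym e))) rj≡j)
    R-block⊆τ : ∀ i → i ∈ upTo (length Q) → in-R-block i ≡ true → (at Q i ≡ᵇ m) ≡ true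
    R-block⊆τ i i∈ Ri = ≡⇒≡ᵇ-true
      (trans (Q≥R i (at τ j) (subst (i <_) eq (∈-upTo⁻ i∈)) (τ< j j<) (trans (≡ᵇ-true⇒≡ _ _ Ri) (sym e)))
             (proj₂ (at-block Q m j j<)))

between : List ℕ → List ℕ → List (List ℕ)
between P Q = filterᵇ (λ R → coarser Q R) (coarsenings P)

∈-between⁺ : ∀ P Q R → R ∈ coarsenings P → Coarser Q R → R ∈ between P Q
∈-between⁺ P Q R R∈ Q≥R = ∈-filterᵇ⁺ (λ R → coarser Q R) R∈ (Coarser⇒coarser Q R Q≥R)

∈-between⁻ : ∀ P Q R → R ∈ between P Q → R ∈ coarsenings P × Coarser Q R
∈-between⁻ P Q R h with ∈-filterᵇ⁻ (λ R → coarser Q R) (coarsenings P) h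
... | R∈ , Q≥R = R∈ , coarser⇒Coarser Q R Q≥R

between-unique : ∀ P Q → Unique (between P Q)
between-unique P Q = filterᵇ-unique _ (coarsenings-unique P)

restrict-∈-coarsenings : ∀ P Q R m → Q ∈ coarsenings P → R ∈ between P Q → m ∈ leaders Q →
                         restrict R (block Q m) ∈ coarsenings (restrict P (block Q m))
restrict-∈-coarsenings P Q R m Q∈ R∈ m∈ with ∈-between⁻ P Q R R∈
... | R∈′ , _ with ∈-coarsenings⁻ P R R∈′ | ∈-coarsenings⁻ P Q Q∈ | ∈-leaders⁻ Q m m∈
... | eqR , vR , R≥P | eqQ , _ , _ | m< , e =
  ∈-coarsenings⁺ (restrict P τ) (restrict R τ) (trans (length-restrict R τ) (sym (length-restrict P τ)))
    (IsNCP⇒valid (restrict R τ) (restrict-IsNCP R τ (valid⇒IsNCP R vR) (block-increasing Q m)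
       (All.map (subst (_ <_) (trans eqQ (sym eqR))) (block-bounded Q m)) (block-nonempty Q m m< e)))
    (restrict-Coarser R P τ R≥P (All.map (subst (_ <_) eqQ) (block-bounded Q m)))
  where τ = block Q m

private
  restrict-agree⇒≤ : ∀ P Q R R′ → Q ∈ coarsenings P → R ∈ between P Q → R′ ∈ between P Q →
                     (∀ m → m ∈ leaders Q → restrict R (block Q m) ≡ restrict R′ (block Q m)) →
                     ∀ i → i < length P → at R′ i ≤ at R i
  restrict-agree⇒≤ P Q R R′ Q∈ R∈ R′∈ agree i i< with ∈-between⁻ P Q R R∈ | ∈-between⁻ P Q R′ R′∈
  ... | R∈′ , Q≥R | R′∈′ , _ with ∈-coarsenings⁻ P R R∈′ | ∈-coarsenings⁻ P R′ R′∈′ | ∈-coarsenings⁻ P Q Q∈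
  ... | eqR , vR , _ | eqR′ , vR′ , _ | eqQ , vQ , _ =
    subst (_≤ x) R′x≡R′i (proj₁ (canR′ x (subst (x <_) (sym eqR′) x<)))
    where
    canR = proj₁ (proj₂ (valid⇒IsNCP R vR))
    canR′ = proj₁ (proj₂ (valid⇒IsNCP R′ vR′))
    canQ = proj₁ (proj₂ (valid⇒IsNCP Q vQ))
    i<Q = subst (i <_) (sym eqQ) i<
    i<R = subst (i <_) (sym eqR) i<
    m = at Q i
    τ = block Q m
    x = at R i
    x< = ≤-<-trans (proj₁ (canR i i<R)) i<
    sx = indexOf-spec τ x (∈-block⁺ Q m x (subst (x <_) (sym eqQ) x<)
                             (Q≥R x i (subst (x <_) (sym eqR) x<) i<R (proj₂ (canR i i<R))))
    si = indexOf-spec τ i (∈-block⁺ Q m i i<Q refl)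
    same-in-R : at (restrict R τ) (indexOf τ x) ≡ at (restrict R τ) (indexOf τ i)
    same-in-R = restrict-same-block⁺ R τ _ _ (proj₁ sx) (proj₁ si)
      (trans (cong (at R) (proj₂ sx)) (trans (proj₂ (canR i i<R)) (sym (cong (at R) (proj₂ si)))))
    same-in-R′ : at (restrict R′ τ) (indexOf τ x) ≡ at (restrict R′ τ) (indexOf τ i)
    same-in-R′ = subst (λ z → at z (indexOf τ x) ≡ at z (indexOf τ i))
                       (agree m (label-∈-leaders Q canQ i i<Q)) same-in-R
    R′x≡R′i : at R′ x ≡ at R′ i
    R′x≡R′i = trans (sym (cong (at R′) (proj₂ sx)))
      (trans (restrict-same-block⁻ R′ τ _ _ (proj₁ sx) (proj₁ si) same-in-R′) (cong (at R′) (proj₂ si)))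

restrict-between-injective : ∀ P Q R R′ → Q ∈ coarsenings P → R ∈ between P Q → R′ ∈ between P Q →
                             (∀ m → m ∈ leaders Q → restrict R (block Q m) ≡ restrict R′ (block Q m)) → R ≡ R′
restrict-between-injective P Q R R′ Q∈ R∈ R′∈ agree = at-ext R R′ (trans eqR (sym eqR′)) λ i i< →
  let i<P = subst (i <_) eqR i< in
  ≤-antisym (restrict-agree⇒≤ P Q R′ R Q∈ R′∈ R∈ (λ m m∈ → sym (agree m m∈)) i i<P)
            (restrict-agree⇒≤ P Q R R′ Q∈ R∈ R′∈ agree i i<P)
  where
  eqR = proj₁ (∈-coarsenings⁻ P R (proj₁ (∈-between⁻ P Q R R∈)))
  eqR′ = proj₁ (∈-coarsenings⁻ P R′ (proj₁ (∈-between⁻ P Q R′ R′∈)))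

module Gluing (P Q : List ℕ) (piece : ℕ → List ℕ) (ncpP : IsNCP P) (Q∈ : Q ∈ coarsenings P)
              (piece∈ : ∀ m → m ∈ leaders Q → piece m ∈ coarsenings (restrict P (block Q m))) where

  private
    n : ℕ
    n = length P
    eqQ : length Q ≡ n
    eqQ = proj₁ (∈-coarsenings⁻ P Q Q∈)
    ncpQ : IsNCP Q
    ncpQ = valid⇒IsNCP Q (proj₁ (proj₂ (∈-coarsenings⁻ P Q Q∈)))
    canQ : Canonical Q
    canQ = proj₁ (proj₂ ncpQ)

    <Q : ∀ {i} → i < n → i < length Q
    <Q = subst (_ <_) (sym eqQ)

    module _ (m : ℕ) (m∈ : m ∈ leaders Q) where
      τ : List ℕ
      τ = block Q m
      private
        h-piece : length (piece m) ≡ length (restrict P τ) × T (valid (piece m)) × Coarser (piece m) (restrict P τ)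
        h-piece = ∈-coarsenings⁻ (restrict P τ) (piece m) (piece∈ m m∈)
      length-piece : length (piece m) ≡ length τ
      length-piece = trans (proj₁ h-piece) (length-restrict P τ)
      ncp-piece : IsNCP (piece m)
      ncp-piece = valid⇒IsNCP (piece m) (proj₁ (proj₂ h-piece))
      piece≥P : Coarser (piece m) (restrict P τ)
      piece≥P = proj₂ (proj₂ h-piece)
      <piece : ∀ {p} → p < length τ → p < length (piece m)
      <piece = subst (_ <_) (sym length-piece)
      piece-label-≤ : ∀ p → p < length τ → at (piece m) p ≤ p
      piece-label-≤ p p< = proj₁ (proj₁ (proj₂ ncp-piece) p (<piece p<))
      piece-label-idem : ∀ p → p < length τ → at (piece m) (at (piece m) p) ≡ at (piece m) p
      piece-label-idem p p< = proj₂ (proj₁ (proj₂ ncp-piece) p (<piece p<))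
      piece-label-< : ∀ p → p < length τ → at (piece m) p < length τ
      piece-label-< p p< = ≤-<-trans (piece-label-≤ p p<) p<
      τ< : ∀ p → p < length τ → at τ p < n
      τ< p p< = subst (_ <_) eqQ (proj₁ (at-block Q m p p<))
      Q-at-τ : ∀ p → p < length τ → at Q (at τ p) ≡ m
      Q-at-τ p p< = proj₂ (at-block Q m p p<)

  -- i is the p-th element of its Q-block τ; the piece on τ labels p by a position in τ, mapped back through τ.
  glueLabel : ℕ → ℕ
  glueLabel i = at (block Q (at Q i)) (at (piece (at Q i)) (indexOf (block Q (at Q i)) i))

  glued : List ℕ
  glued = map glueLabel (upTo n)

  private
    R : List ℕ
    R = glued

    length-R : length R ≡ n
    length-R = trans (length-map glueLabel (upTo n)) (length-upTo n)

    at-R : ∀ i → i < n → at R i ≡ glueLabel i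
    at-R i i< = trans (at-map glueLabel (upTo n) i (subst (i <_) (sym (length-upTo n)) i<))
                      (cong glueLabel (at-upTo n i i<))

    at-R-τ : ∀ m (m∈ : m ∈ leaders Q) p → p < length (τ m m∈) → at R (at (τ m m∈) p) ≡ at (τ m m∈) (at (piece m) p)
    at-R-τ m m∈ p p< =
      trans (at-R _ (τ< m m∈ p p<))
        (subst (λ z → glueLabel (at (block Q m) p) ≡ at (block Q z) (at (piece z) p)) (Q-at-τ m m∈ p p<)
          (cong (λ z → at (block Q (at Q (at (block Q m) p))) (at (piece (at Q (at (block Q m) p))) z))
            (trans (cong (λ z → indexOf (block Q z) (at (block Q m) p)) (Q-at-τ m m∈ p p<))
                   (indexOf-at (block Q m) (block-increasing Q m) p p<))))

    position-in-block : ∀ i j → i < n → j < n → at Q j ≡ at Q i →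
      indexOf (block Q (at Q i)) j < length (block Q (at Q i)) ×
      at (block Q (at Q i)) (indexOf (block Q (at Q i)) j) ≡ j
    position-in-block i j i< j< e = indexOf-spec (block Q (at Q i)) j (∈-block⁺ Q (at Q i) j (<Q j<) e)

    module Point (i : ℕ) (i< : i < n) where
      m : ℕ
      m = at Q i
      m∈ : m ∈ leaders Q
      m∈ = label-∈-leaders Q canQ i (<Q i<)
      τᵢ : List ℕ
      τᵢ = τ m m∈
      p : ℕ
      p = indexOf τᵢ i
      spec : p < length τᵢ × at τᵢ p ≡ i
      spec = position-in-block i i i< i< refl
      p< : p < length τᵢ
      p< = proj₁ spec
      R-at-i : at R i ≡ at τᵢ (at (piece m) p)
      R-at-i = at-R i i<

    Q-at-R : ∀ i → i < n → at Q (at R i) ≡ at Q i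
    Q-at-R i i< = trans (cong (at Q) R-at-i) (Q-at-τ m m∈ _ (piece-label-< m m∈ p p<)) where open Point i i<

    R-same-block⇒piece : ∀ m (m∈ : m ∈ leaders Q) p q → p < length (τ m m∈) → q < length (τ m m∈) →
                     at R (at (τ m m∈) p) ≡ at R (at (τ m m∈) q) → at (piece m) p ≡ at (piece m) q
    R-same-block⇒piece m m∈ p q p< q< e = Increasing-injective (τ m m∈) (block-increasing Q m) _ _
      (piece-label-< m m∈ p p<) (piece-label-< m m∈ q q<) (trans (sym (at-R-τ m m∈ p p<)) (trans e (at-R-τ m m∈ q q<)))

    piece-same-block⇒R : ∀ m (m∈ : m ∈ leaders Q) p q → p < length (τ m m∈) → q < length (τ m m∈) →
                     at (piece m) p ≡ at (piece m) q → at R (at (τ m m∈) p) ≡ at R (at (τ m m∈) q)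
    piece-same-block⇒R m m∈ p q p< q< e = trans (at-R-τ m m∈ p p<) (trans (cong (at (τ m m∈)) e) (sym (at-R-τ m m∈ q q<)))

    Q≥R : Coarser Q R
    Q≥R i j i<′ j<′ e = trans (sym (Q-at-R i i<)) (trans (cong (at Q) e) (Q-at-R j j<))
      where i< = subst (i <_) length-R i<′
            j< = subst (j <_) length-R j<′

    canonical-R : Canonical R
    canonical-R i i<′ = R-at-i≤i , R-idem
      where
      i< = subst (i <_) length-R i<′
      open Point i i<
      R-at-i≤i : at R i ≤ i
      R-at-i≤i = subst₂ _≤_ (sym R-at-i) (proj₂ spec)
                   (Increasing-≤ τᵢ (block-increasing Q m) _ _ (piece-label-≤ m m∈ p p<) p<)
      R-idem : at R (at R i) ≡ at R i
      R-idem = trans (cong (at R) R-at-i) (trans (at-R-τ m m∈ _ (piece-label-< m m∈ p p<))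
                 (trans (cong (at τᵢ) (piece-label-idem m m∈ p p<)) (sym R-at-i)))

    -- A crossing of R lies inside one block of Q (as Q is noncrossing), hence is a crossing of the piece there.
    noncrossing-R : NonCrossing R
    noncrossing-R a c b d a<c c<b b<d d<′ eab ecd =
      trans (sym (cong (at R) (proj₂ sa)))
            (trans (piece-same-block⇒R m m∈ _ _ (proj₁ sa) (proj₁ sc) piece-ac) (cong (at R) (proj₂ sc)))
      where
      d< = subst (d <_) length-R d<′
      b< = <-trans b<d d<
      c< = <-trans c<b b<
      a< = <-trans a<c c<
      Qab : at Q a ≡ at Q b
      Qab = Q≥R a b (subst (a <_) (sym length-R) a<) (subst (b <_) (sym length-R) b<) eab
      Qcd : at Q c ≡ at Q d
      Qcd = Q≥R c d (subst (c <_) (sym length-R) c<) d<′ ecd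
      Qac : at Q a ≡ at Q c
      Qac = proj₂ (proj₂ ncpQ) a c b d a<c c<b b<d (<Q d<) Qab Qcd
      open Point a a<
      sa = position-in-block a a a< a< refl
      sb = position-in-block a b a< b< (sym Qab)
      sc = position-in-block a c a< c< (sym Qac)
      sd = position-in-block a d a< d< (sym (trans Qac Qcd))
      index-< : ∀ {x y} (sx : indexOf τᵢ x < length τᵢ × at τᵢ (indexOf τᵢ x) ≡ x)
                        (sy : indexOf τᵢ y < length τᵢ × at τᵢ (indexOf τᵢ y) ≡ y) →
                x < y → indexOf τᵢ x < indexOf τᵢ y
      index-< sx sy x<y = Increasing-<⁻ τᵢ (block-increasing Q m) _ _ (proj₁ sx) (proj₁ sy)
                            (subst₂ _<_ (sym (proj₂ sx)) (sym (proj₂ sy)) x<y)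
      piece-same : ∀ {x y} (sx : indexOf τᵢ x < length τᵢ × at τᵢ (indexOf τᵢ x) ≡ x)
                       (sy : indexOf τᵢ y < length τᵢ × at τᵢ (indexOf τᵢ y) ≡ y) →
               at R x ≡ at R y → at (piece m) (indexOf τᵢ x) ≡ at (piece m) (indexOf τᵢ y)
      piece-same sx sy e = R-same-block⇒piece m m∈ _ _ (proj₁ sx) (proj₁ sy)
                         (trans (cong (at R) (proj₂ sx)) (trans e (sym (cong (at R) (proj₂ sy)))))
      piece-ac : at (piece m) (indexOf τᵢ a) ≡ at (piece m) (indexOf τᵢ c)
      piece-ac = proj₂ (proj₂ (ncp-piece m m∈)) _ _ _ _ (index-< sa sc a<c) (index-< sc sb c<b) (index-< sb sd b<d)
              (<piece m m∈ (proj₁ sd)) (piece-same sa sb eab) (piece-same sc sd ecd)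

    R≥P : Coarser R P
    R≥P i j i< j< e =
      trans (sym (cong (at R) (proj₂ si)))
            (trans (piece-same-block⇒R m m∈ _ _ (proj₁ si) (proj₁ sj) piece-ij) (cong (at R) (proj₂ sj)))
      where
      open Point i i<
      si = position-in-block i i i< i< refl
      sj = position-in-block i j i< j< (sym (proj₂ (proj₂ (∈-coarsenings⁻ P Q Q∈)) i j i< j< e))
      same-in-P|τ : at (restrict P τᵢ) (indexOf τᵢ i) ≡ at (restrict P τᵢ) (indexOf τᵢ j)
      same-in-P|τ = restrict-same-block⁺ P τᵢ _ _ (proj₁ si) (proj₁ sj)
                      (trans (cong (at P) (proj₂ si)) (trans e (sym (cong (at P) (proj₂ sj)))))
      piece-ij : at (piece m) (indexOf τᵢ i) ≡ at (piece m) (indexOf τᵢ j)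
      piece-ij = piece≥P m m∈ _ _ (subst (indexOf τᵢ i <_) (sym (length-restrict P τᵢ)) (proj₁ si))
                         (subst (indexOf τᵢ j <_) (sym (length-restrict P τᵢ)) (proj₁ sj)) same-in-P|τ

  glued-∈-between : glued ∈ between P Q
  glued-∈-between = ∈-between⁺ P Q R
    (∈-coarsenings⁺ P R length-R
      (IsNCP⇒valid R (subst (1 ≤_) (sym length-R) (proj₁ ncpP) , canonical-R , noncrossing-R)) R≥P)
    Q≥R

  restrict-glued : ∀ m (m∈ : m ∈ leaders Q) → restrict R (block Q m) ≡ piece m
  restrict-glued m m∈ = at-ext (restrict R τₘ) (piece m) (trans (length-restrict R τₘ) (sym (length-piece m m∈))) λ j j<′ →
    let j< = subst (j <_) (length-restrict R τₘ) j<′ in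
    begin
      at (restrict R τₘ) j
    ≡⟨ at-restrict R τₘ j j< ⟩
      firstIndex (λ y → at R y ≡ᵇ at R (at τₘ j)) τₘ
    ≡⟨ cong (firstIndex (λ y → at R y ≡ᵇ at R (at τₘ j))) (sym (map-at-upTo τₘ)) ⟩
      firstIndex (λ y → at R y ≡ᵇ at R (at τₘ j)) (map (at τₘ) (upTo (length τₘ)))
    ≡⟨ firstIndex-map _ (at τₘ) (upTo (length τₘ)) ⟩
      firstIndex (λ y → at R (at τₘ y) ≡ᵇ at R (at τₘ j)) (upTo (length τₘ))
    ≡⟨ firstIndex-cong _ _ (upTo (length τₘ)) (λ y y∈ →
         ≡ᵇ-cong-⇔ (R-same-block⇒piece m m∈ y j (∈-upTo⁻ y∈) j<) (piece-same-block⇒R m m∈ y j (∈-upTo⁻ y∈) j<)) ⟩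
      firstIndex (λ y → at (piece m) y ≡ᵇ at (piece m) j) (upTo (length τₘ))
    ≡⟨ cong (λ z → firstIndex (λ y → at (piece m) y ≡ᵇ at (piece m) j) (upTo z)) (sym (length-piece m m∈)) ⟩
      firstIndex (λ y → at (piece m) y ≡ᵇ at (piece m) j) (upTo (length (piece m)))
    ≡⟨ firstIndex-canonical (piece m) j (proj₁ (proj₂ (ncp-piece m m∈))) (<piece m m∈ j<) ⟩
      at (piece m) j
    ∎
    where
    open ≡-Reasoning
    τₘ = τ m m∈

map-unique : ∀ {A B : Set} (h : A → B) xs → Unique xs →
             (∀ x y → x ∈ xs → y ∈ xs → h x ≡ h y → x ≡ y) → Unique (map h xs)
map-unique h []       _          _   = []
map-unique h (x ∷ xs) (x∉ ∷ uxs) inj =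
  All.tabulate (λ z∈ e → fresh z∈ e) ∷ map-unique h xs uxs (λ a b a∈ b∈ → inj a b (there a∈) (there b∈))
  where
  fresh : ∀ {z} → z ∈ map h xs → h x ≡ z → _
  fresh z∈ e with ∈-map⁻ h z∈
  ... | y , y∈ , refl = All.lookup x∉ y∈ (inj x y (here refl) (there y∈) e)

-- Finite sums in a commutative monoid

module BigOperator {a ℓ} (M : CommutativeMonoid a ℓ) where
  open CommutativeMonoid M renaming (refl to ≈-refl; sym to ≈-sym; trans to ≈-trans; reflexive to ≡⇒≈)
  open import Algebra.Properties.CommutativeSemigroup commutativeSemigroup using (interchange)
  open import Relation.Binary.Reasoning.Setoid setoid

  fold : List Carrier → Carrier
  fold = foldr _∙_ ε

  fold-cong : ∀ {A : Set} (f g : A → Carrier) xs → (∀ x → x ∈ xs → f x ≈ g x) →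
              fold (map f xs) ≈ fold (map g xs)
  fold-cong f g []       h = ≈-refl
  fold-cong f g (x ∷ xs) h = ∙-cong (h x (here refl)) (fold-cong f g xs (λ y y∈ → h y (there y∈)))

  fold-map-∘ : ∀ {A B : Set} (f : B → Carrier) (g : A → B) xs → fold (map f (map g xs)) ≈ fold (map (f ∘ g) xs)
  fold-map-∘ f g xs = ≡⇒≈ (cong fold (sym (map-∘ xs)))

  fold-++ : ∀ xs ys → fold (xs ++ ys) ≈ fold xs ∙ fold ys
  fold-++ []       ys = ≈-sym (identityˡ _)
  fold-++ (x ∷ xs) ys = ≈-trans (∙-congˡ (fold-++ xs ys)) (≈-sym (assoc _ _ _))

  fold-distrib : ∀ {A : Set} (f g : A → Carrier) xs →
                 fold (map (λ x → f x ∙ g x) xs) ≈ fold (map f xs) ∙ fold (map g xs)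
  fold-distrib f g []       = ≈-sym (identityˡ _)
  fold-distrib f g (x ∷ xs) = ≈-trans (∙-congˡ (fold-distrib f g xs)) (interchange _ _ _ _)

  fold-filterᵇ : ∀ {A : Set} (f : A → Carrier) (p : A → Bool) xs →
                 fold (map f (filterᵇ p xs)) ≈ fold (map (λ x → if p x then f x else ε) xs)
  fold-filterᵇ f p []       = ≈-refl
  fold-filterᵇ f p (x ∷ xs) with p x
  ... | true  = ∙-congˡ (fold-filterᵇ f p xs)
  ... | false = ≈-trans (fold-filterᵇ f p xs) (≈-sym (identityˡ _))

  fold-ε : ∀ {A : Set} (f : A → Carrier) xs → (∀ x → x ∈ xs → f x ≈ ε) → fold (map f xs) ≈ ε
  fold-ε f []       h = ≈-refl
  fold-ε f (x ∷ xs) h = ≈-trans (∙-cong (h x (here refl)) (fold-ε f xs (λ y y∈ → h y (there y∈)))) (identityˡ _)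

  fold-single : ∀ {A : Set} (f : A → Carrier) xs (a : A) → Unique xs → a ∈ xs →
                (∀ x → x ∈ xs → x ≢ a → f x ≈ ε) → fold (map f xs) ≈ f a
  fold-single f (x ∷ xs) a (x∉ ∷ u) (here refl) h =
    ≈-trans (∙-congˡ (fold-ε f xs (λ y y∈ → h y (there y∈) (λ y≡x → All.lookup x∉ y∈ (sym y≡x))))) (identityʳ _)
  fold-single f (x ∷ xs) a (x∉ ∷ u) (there a∈) h =
    ≈-trans (∙-cong (h x (here refl) (All.lookup x∉ a∈)) (fold-single f xs a u a∈ (λ y y∈ → h y (there y∈))))
          (identityˡ _)

  fold-if : ∀ {A : Set} (b : Bool) (f : A → Carrier) xs →
            (if b then fold (map f xs) else ε) ≈ fold (map (λ x → if b then f x else ε) xs)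
  fold-if true  f xs = ≈-refl
  fold-if false f xs = ≈-sym (fold-ε (λ _ → ε) xs (λ _ _ → ≈-refl))

  fold-comm : ∀ {A B : Set} (f : A → B → Carrier) xs ys →
              fold (map (λ x → fold (map (f x) ys)) xs) ≈ fold (map (λ y → fold (map (λ x → f x y) xs)) ys)
  fold-comm f []       ys = ≈-sym (fold-ε _ ys (λ _ _ → ≈-refl))
  fold-comm f (x ∷ xs) ys = ≈-trans (∙-congˡ (fold-comm f xs ys)) (≈-sym (fold-distrib (f x) _ ys))

  fold-concatMap : ∀ {A B : Set} (f : B → Carrier) (g : A → List B) xs →
                   fold (map f (concatMap g xs)) ≈ fold (map (λ x → fold (map f (g x))) xs)
  fold-concatMap f g []       = ≈-refl
  fold-concatMap f g (x ∷ xs) =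
    ≈-trans (≡⇒≈ (cong fold (map-++ f (g x) (concatMap g xs))))
          (≈-trans (fold-++ (map f (g x)) _) (∙-congˡ (fold-concatMap f g xs)))

  -- Unique lists with the same members are permutations of each other.
  fold-reindex : ∀ {A B : Set} (g : B → Carrier) (h : A → B) xs ys → Unique xs → Unique ys →
                 (∀ x y → x ∈ xs → y ∈ xs → h x ≡ h y → x ≡ y) →
                 (∀ x → x ∈ xs → h x ∈ ys) → (∀ y → y ∈ ys → Σ A λ x → x ∈ xs × h x ≡ y) →
                 fold (map (g ∘ h) xs) ≈ fold (map g ys)
  fold-reindex g h xs ys uxs uys inj into onto =
    ≈-trans (≡⇒≈ (cong fold (map-∘ xs)))
      (PermSetoid.foldr-commMonoid setoid isCommutativeMonoid
        (↭⇒↭ₛ′ isEquivalence (Perm.map⁺ g (∼bag⇒↭ (unique∧set⇒bag (map-unique h xs uxs inj) uys (mk⇔ into′ onto′))))))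
    where
    into′ : ∀ {z} → z ∈ map h xs → z ∈ ys
    into′ z∈ with ∈-map⁻ h z∈
    ... | x , x∈ , refl = into x x∈
    onto′ : ∀ {z} → z ∈ ys → z ∈ map h xs
    onto′ {z} z∈ with onto z z∈
    ... | x , x∈ , refl = ∈-map⁺ h x∈

-- The convolution of characters

module Characters {c ℓ} (K : CommutativeRing c ℓ) where

  open CommutativeRing K hiding (zero) renaming (refl to ≈-refl; sym to ≈-sym; trans to ≈-trans; reflexive to ≡⇒≈)
  open import Relation.Binary.Reasoning.Setoid setoid
  module Sum  = BigOperator +-commutativeMonoid
  module Prod = BigOperator *-commutativeMonoid
  open Sum using () renaming (fold to ∑)
  open Prod using () renaming (fold to ∏)

  Char : Set c
  Char = Character K

  infixl 7 _✶_
  _✶_ : Char → Char → Char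
  _✶_ = _⋆_ K

  infix 4 _≋_
  _≋_ : Char → Char → Set ℓ
  _≋_ = _≈χ_ K

  ε : Char
  ε = εA K

  app-valid : ∀ (φ : Char) l (v : T (valid l)) → app K φ l ≡ φ (l , v)
  app-valid φ l v with T? (valid l)
  ... | yes v′ = cong (λ w → φ (l , w)) (T-irrelevant v′ v)
  ... | no ¬v = ⊥-elim (¬v v)

  app-cong : ∀ {φ ψ : Char} → φ ≋ ψ → ∀ l → app K φ l ≈ app K ψ l
  app-cong h l with T? (valid l)
  ... | yes v = h (l , v)
  ... | no _  = ≈-refl

  blockProduct : Char → List ℕ → List ℕ → Carrier
  blockProduct ψ P Q = ∏ (map (λ τ → app K ψ (restrict P τ)) (blocks Q))

  summand : Char → Char → List ℕ → List ℕ → Carrier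
  summand φ ψ P Q = app K φ Q * blockProduct ψ P Q

  convolution : Char → Char → List ℕ → Carrier
  convolution φ ψ P = ∑ (map (summand φ ψ P) (coarsenings P))

  ✶-cong : ∀ {φ φ′ ψ ψ′} → φ ≋ φ′ → ψ ≋ ψ′ → (φ ✶ ψ) ≋ (φ′ ✶ ψ′)
  ✶-cong h₁ h₂ (P , _) = Sum.fold-cong _ _ (coarsenings P) λ Q _ →
    *-cong (app-cong h₁ Q) (Prod.fold-cong _ _ (blocks Q) (λ τ _ → app-cong h₂ (restrict P τ)))

  *-distribˡ-∑ : ∀ {A : Set} (a : Carrier) (f : A → Carrier) xs → a * ∑ (map f xs) ≈ ∑ (map (λ x → a * f x) xs)
  *-distribˡ-∑ a f []       = zeroʳ a
  *-distribˡ-∑ a f (x ∷ xs) = ≈-trans (distribˡ a (f x) _) (+-congˡ (*-distribˡ-∑ a f xs))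

  *-distribʳ-∑ : ∀ {A : Set} (a : Carrier) (f : A → Carrier) xs → ∑ (map f xs) * a ≈ ∑ (map (λ x → f x * a) xs)
  *-distribʳ-∑ a f []       = zeroˡ a
  *-distribʳ-∑ a f (x ∷ xs) = ≈-trans (distribʳ a (f x) _) (+-congˡ (*-distribʳ-∑ a f xs))

  ∏-zero : ∀ {A : Set} (f : A → Carrier) xs x → x ∈ xs → f x ≈ 0# → ∏ (map f xs) ≈ 0#
  ∏-zero f (y ∷ xs) x (here refl) e = ≈-trans (*-congʳ e) (zeroˡ _)
  ∏-zero f (y ∷ xs) x (there x∈)  e = ≈-trans (*-congˡ (∏-zero f xs x x∈ e)) (zeroʳ _)

  ∏-∑-expand : ∀ {A B : Set} (bs : List B) (L : B → List A) (G : B → A → Carrier) →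
               ∏ (map (λ b → ∑ (map (G b) (L b))) bs) ≈ ∑ (map (λ t → ∏ (zipWith G bs t)) (cartesian (map L bs)))
  ∏-∑-expand []       L G = ≈-sym (+-identityʳ 1#)
  ∏-∑-expand (b ∷ bs) L G = begin
      ∑ (map (G b) (L b)) * ∏ (map (λ b → ∑ (map (G b) (L b))) bs)
    ≈⟨ *-congˡ (∏-∑-expand bs L G) ⟩
      ∑ (map (G b) (L b)) * ∑ (map choiceTerm choices)
    ≈⟨ *-distribʳ-∑ _ (G b) (L b) ⟩
      ∑ (map (λ x → G b x * ∑ (map choiceTerm choices)) (L b))
    ≈⟨ Sum.fold-cong _ _ (L b) (λ x _ →
         ≈-trans (*-distribˡ-∑ (G b x) choiceTerm choices) (≡⇒≈ (cong ∑ (map-∘ choices)))) ⟩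
      ∑ (map (λ x → ∑ (map choiceTerm′ (map (x ∷_) choices))) (L b))
    ≈⟨ Sum.fold-concatMap choiceTerm′ (λ x → map (x ∷_) choices) (L b) ⟨
      ∑ (map choiceTerm′ (concatMap (λ x → map (x ∷_) choices) (L b)))
    ∎
    where
    choices = cartesian (map L bs)
    choiceTerm = λ t → ∏ (zipWith G bs t)
    choiceTerm′ = λ t → ∏ (zipWith G (b ∷ bs) t)

  εA-oneBlock : ∀ l → T (valid l) → oneBlock l ≡ true → app K ε l ≈ 1#
  εA-oneBlock l v h = ≡⇒≈ (trans (app-valid ε l v) (cong (λ b → if b then 1# else 0#) h))

  εA-notOneBlock : ∀ l → oneBlock l ≡ false → app K ε l ≈ 0#
  εA-notOneBlock l h with T? (valid l)
  ... | yes _ rewrite h = ≈-refl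
  ... | no _            = ≈-refl

  ∑-coarsenings-split : ∀ (f : List ℕ → Carrier) P → IsNCP P →
    ∑ (map f (coarsenings P)) ≈ f (I (length P)) + ∑ (map (λ Q → if oneBlock Q then 0# else f Q) (coarsenings P))
  ∑-coarsenings-split f P ncpP = begin
      ∑ (map f (coarsenings P))
    ≈⟨ Sum.fold-cong _ _ (coarsenings P) (λ Q _ → split Q) ⟩
      ∑ (map (λ Q → onI Q + offI Q) (coarsenings P))
    ≈⟨ Sum.fold-distrib onI offI (coarsenings P) ⟩
      ∑ (map onI (coarsenings P)) + ∑ (map offI (coarsenings P))
    ≈⟨ +-congʳ (Sum.fold-single onI (coarsenings P) (I n) (coarsenings-unique P) (I∈coarsenings P ncpP) onI-vanishes) ⟩
      onI (I n) + ∑ (map offI (coarsenings P))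
    ≈⟨ +-congʳ (≡⇒≈ (cong (λ b → if b then f (I n) else 0#) (oneBlock-I n))) ⟩
      f (I n) + ∑ (map offI (coarsenings P))
    ∎
    where
    n = length P
    onI offI : List ℕ → Carrier
    onI Q = if oneBlock Q then f Q else 0#
    offI Q = if oneBlock Q then 0# else f Q
    split : ∀ Q → f Q ≈ onI Q + offI Q
    split Q with oneBlock Q
    ... | true  = ≈-sym (+-identityʳ _)
    ... | false = ≈-sym (+-identityˡ _)
    onI-vanishes : ∀ Q → Q ∈ coarsenings P → Q ≢ I n → onI Q ≈ 0#
    onI-vanishes Q Q∈ Q≢I with oneBlock Q in e
    ... | true  = ⊥-elim (Q≢I (coarsening-oneBlock⇒≡I P Q Q∈ e))
    ... | false = ≈-refl

  summand-I : ∀ (φ ψ : Char) P m (v : T (valid P)) → length P ≡ suc m →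
              summand φ ψ P (I (suc m)) ≈ φ (I (suc m) , valid-I m) * ψ (P , v)
  summand-I φ ψ P m v len = begin
      app K φ (I (suc m)) * ∏ (map (λ τ → app K ψ (restrict P τ)) (blocks (I (suc m))))
    ≈⟨ *-cong (≡⇒≈ (app-valid φ (I (suc m)) (valid-I m)))
              (≡⇒≈ (cong (λ bs → ∏ (map (λ τ → app K ψ (restrict P τ)) bs)) (blocks-I m))) ⟩
      φ (I (suc m) , valid-I m) * (app K ψ (restrict P (upTo (suc m))) * 1#)
    ≈⟨ *-congˡ (≈-trans (*-identityʳ _) (≡⇒≈ (trans (cong (app K ψ) restrict-all) (app-valid ψ P v)))) ⟩
      φ (I (suc m) , valid-I m) * ψ (P , v)
    ∎
    where
    restrict-all : restrict P (upTo (suc m)) ≡ P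
    restrict-all = subst (λ n → restrict P (upTo n) ≡ P) len
                         (restrict-whole P (proj₁ (proj₂ (valid⇒IsNCP P v))))

  ✶-identityˡ : ∀ (ω : Char) → (ε ✶ ω) ≋ ω
  ✶-identityˡ ω (x ∷ xs , v) = begin
      convolution ε ω P
    ≈⟨ Sum.fold-single _ (coarsenings P) (I n) (coarsenings-unique P) (I∈coarsenings P (valid⇒IsNCP P v)) off-I ⟩
      summand ε ω P (I n)
    ≈⟨ summand-I ε ω P (length xs) v refl ⟩
      ε (I n , valid-I (length xs)) * ω (P , v)
    ≈⟨ ≈-trans (*-congʳ (≡⇒≈ (cong (λ b → if b then 1# else 0#) (oneBlock-I n)))) (*-identityˡ _) ⟩
      ω (P , v)
    ∎
    where
    P = x ∷ xs
    n = length P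
    off-I : ∀ Q → Q ∈ coarsenings P → Q ≢ I n → summand ε ω P Q ≈ 0#
    off-I Q Q∈ Q≢I with oneBlock Q in e
    ... | true  = ⊥-elim (Q≢I (coarsening-oneBlock⇒≡I P Q Q∈ e))
    ... | false = ≈-trans (*-congʳ (εA-notOneBlock Q e)) (zeroˡ _)

  ✶-identityʳ : ∀ (φ : Char) → (φ ✶ ε) ≋ φ
  ✶-identityʳ φ (P , v) = begin
      convolution φ ε P
    ≈⟨ Sum.fold-single _ (coarsenings P) P (coarsenings-unique P) (∈-coarsenings⁺ P P refl v (λ _ _ _ _ e → e)) off-P ⟩
      app K φ P * ∏ (map (λ τ → app K ε (restrict P τ)) (blocks P))
    ≈⟨ *-congˡ (Prod.fold-ε _ (blocks P) own-blocks) ⟩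
      app K φ P * 1#
    ≈⟨ ≈-trans (*-identityʳ _) (≡⇒≈ (app-valid φ P v)) ⟩
      φ (P , v)
    ∎
    where
    ncpP = valid⇒IsNCP P v
    off-P : ∀ Q → Q ∈ coarsenings P → Q ≢ P → summand φ ε P Q ≈ 0#
    off-P Q Q∈ Q≢P with strict-coarsening-splits-block P Q ncpP Q∈ Q≢P
    ... | m , m∈ , notOne =
      ≈-trans (*-congˡ (∏-zero _ (blocks Q) (block Q m) (∈-map⁺ (block Q) m∈)
                                (εA-notOneBlock (restrict P (block Q m)) notOne)))
              (zeroʳ _)
    own-blocks : ∀ τ → τ ∈ blocks P → app K ε (restrict P τ) ≈ 1#
    own-blocks τ τ∈ with ∈-map⁻ (block P) τ∈
    ... | m , m∈ , refl = εA-oneBlock (restrict P (block P m))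
      (IsNCP⇒valid (restrict P (block P m)) (restrict-block-IsNCP P P m ncpP refl m∈))
      (restrict-own-block-oneBlock P m m∈)

  ✶-I : ∀ (φ ψ : Char) m → (φ ✶ ψ) (I (suc m) , valid-I m) ≈ φ (I (suc m) , valid-I m) * ψ (I (suc m) , valid-I m)
  ✶-I φ ψ m = begin
      convolution φ ψ P
    ≈⟨ ∑-coarsenings-split (summand φ ψ P) P (IsNCP-I m) ⟩
      summand φ ψ P (I (length P)) + ∑ (map (λ Q → if oneBlock Q then 0# else summand φ ψ P Q) (coarsenings P))
    ≈⟨ +-cong (≡⇒≈ (cong (λ n → summand φ ψ P (I n)) (length-I (suc m)))) (Sum.fold-ε _ (coarsenings P) only-I) ⟩
      summand φ ψ P P + 0#
    ≈⟨ ≈-trans (+-identityʳ _) (summand-I φ ψ P m (valid-I m) (length-I (suc m))) ⟩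
      φ (P , valid-I m) * ψ (P , valid-I m)
    ∎
    where
    P = I (suc m)
    only-I : ∀ Q → Q ∈ coarsenings P → (if oneBlock Q then 0# else summand φ ψ P Q) ≈ 0#
    only-I Q Q∈ rewrite coarsening-I-oneBlock m Q Q∈ = ≈-refl

  if-else-1-cong : ∀ {b b′ : Bool} {x y : Carrier} → b ≡ b′ → (b′ ≡ true → x ≈ y) →
                   (if b then x else 1#) ≈ (if b′ then y else 1#)
  if-else-1-cong {b′ = true}  refl h = h refl
  if-else-1-cong {b′ = false} refl h = ≈-refl

  ∏-regroup : ∀ Q → Canonical Q → (w : ℕ → Carrier) →
              ∏ (map (λ m → ∏ (map w (block Q m))) (leaders Q)) ≈ ∏ (map w (upTo (length Q)))
  ∏-regroup Q canQ w = begin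
      ∏ (map (λ m → ∏ (map w (block Q m))) (leaders Q))
    ≈⟨ Prod.fold-filterᵇ (λ m → ∏ (map w (block Q m))) (λ m → at Q m ≡ᵇ m) U ⟩
      ∏ (map (λ m → if at Q m ≡ᵇ m then ∏ (map w (block Q m)) else 1#) U)
    ≈⟨ Prod.fold-cong _ _ U (λ m _ →
         if-else-1-cong {b = at Q m ≡ᵇ m} refl (λ _ → Prod.fold-filterᵇ w (λ i → at Q i ≡ᵇ m) U)) ⟩
      ∏ (map (λ m → if at Q m ≡ᵇ m then ∏ (map (λ i → if at Q i ≡ᵇ m then w i else 1#) U) else 1#) U)
    ≈⟨ Prod.fold-cong _ _ U (λ m _ → Prod.fold-if (at Q m ≡ᵇ m) _ U) ⟩
      ∏ (map (λ m → ∏ (map (λ i → F m i) U)) U)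
    ≈⟨ Prod.fold-comm F U U ⟩
      ∏ (map (λ i → ∏ (map (λ m → F m i) U)) U)
    ≈⟨ Prod.fold-cong _ _ U (λ i i∈ →
         ≈-trans (Prod.fold-single (λ m → F m i) U (at Q i) (Unique.upTo⁺ _) (label∈ i i∈) (off i))
                                           (at-label i i∈)) ⟩
      ∏ (map w U)
    ∎
    where
    U = upTo (length Q)
    F : ℕ → ℕ → Carrier
    F m i = if at Q m ≡ᵇ m then (if at Q i ≡ᵇ m then w i else 1#) else 1#
    label∈ : ∀ i → i ∈ U → at Q i ∈ U
    label∈ i i∈ = let i< = ∈-upTo⁻ i∈ in ∈-upTo⁺ (≤-<-trans (proj₁ (canQ i i<)) i<)
    off : ∀ i m → m ∈ U → m ≢ at Q i → F m i ≈ 1#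
    off i m _ m≢Qi with at Q m ≡ᵇ m
    ... | false = ≈-refl
    ... | true with at Q i ≡ᵇ m in e
    ...   | true  = ⊥-elim (m≢Qi (sym (≡ᵇ-true⇒≡ _ _ e)))
    ...   | false = ≈-refl
    at-label : ∀ i → i ∈ U → F (at Q i) i ≈ w i
    at-label i i∈ rewrite ≡⇒≡ᵇ-true (proj₂ (canQ i (∈-upTo⁻ i∈))) | ≡⇒≡ᵇ-true {at Q i} refl = ≈-refl

  module _ (P Q R : List ℕ) (Q∈ : Q ∈ coarsenings P) (R∈ : R ∈ between P Q) (ψ : Char) where

    private
      R∈′ : R ∈ coarsenings P
      R∈′ = proj₁ (∈-between⁻ P Q R R∈)
      Q≥R : Coarser Q R
      Q≥R = proj₂ (∈-between⁻ P Q R R∈)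
      eqQR : length Q ≡ length R
      eqQR = trans (proj₁ (∈-coarsenings⁻ P Q Q∈)) (sym (proj₁ (∈-coarsenings⁻ P R R∈′)))
      canR : Canonical R
      canR = proj₁ (proj₂ (valid⇒IsNCP R (proj₁ (proj₂ (∈-coarsenings⁻ P R R∈′)))))
      canQ : Canonical Q
      canQ = proj₁ (proj₂ (valid⇒IsNCP Q (proj₁ (proj₂ (∈-coarsenings⁻ P Q Q∈)))))

      w : ℕ → Carrier
      w i = if at R i ≡ᵇ i then app K ψ (restrict P (block R i)) else 1#

      blockProduct-restrict-block : ∀ m →
        blockProduct ψ (restrict P (block Q m)) (restrict R (block Q m)) ≈ ∏ (map w (block Q m))
      blockProduct-restrict-block m = begin
          ∏ (map (λ σ → app K ψ (restrict P|τ σ)) (map (block r) (leaders r)))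
        ≈⟨ Prod.fold-map-∘ _ (block r) (leaders r) ⟩
          ∏ (map (λ j → app K ψ (restrict P|τ (block r j))) (leaders r))
        ≈⟨ Prod.fold-filterᵇ (λ j → app K ψ (restrict P|τ (block r j))) (λ j → at r j ≡ᵇ j) (upTo (length r)) ⟩
          ∏ (map w′ (upTo (length r)))
        ≈⟨ ≡⇒≈ (cong (λ n → ∏ (map w′ (upTo n))) (length-restrict R τ)) ⟩
          ∏ (map w′ (upTo (length τ)))
        ≈⟨ Prod.fold-cong _ _ (upTo (length τ)) w′≈w ⟩
          ∏ (map (λ j → w (at τ j)) (upTo (length τ)))
        ≈⟨ Prod.fold-map-∘ w (at τ) (upTo (length τ)) ⟨
          ∏ (map w (map (at τ) (upTo (length τ))))
        ≈⟨ ≡⇒≈ (cong (λ z → ∏ (map w z)) (map-at-upTo τ)) ⟩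
          ∏ (map w τ)
        ∎
        where
        open BlockOfCoarser Q R eqQR canR Q≥R m
        τ = block Q m
        r = restrict R τ
        P|τ = restrict P τ
        w′ : ℕ → Carrier
        w′ j = if at r j ≡ᵇ j then app K ψ (restrict P|τ (block r j)) else 1#
        w′≈w : ∀ j → j ∈ upTo (length τ) → w′ j ≈ w (at τ j)
        w′≈w j j∈ = if-else-1-cong (≡ᵇ-cong-⇔ (restrict-leader⇒leader j j<) (leader⇒restrict-leader j j<)) λ e →
            ≡⇒≈ (cong (app K ψ) (trans (restrict-restrict P τ (block r j) block<)
                                        (cong (restrict P) (map-block-restrict j j< (≡ᵇ-true⇒≡ _ _ e)))))
          where
          j< = ∈-upTo⁻ j∈
          block< : All (_< length τ) (block r j)
          block< = All.map (subst (_ <_) (length-restrict R τ)) (block-bounded r j)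

    blockProduct-restrict : ∏ (map (λ m → blockProduct ψ (restrict P (block Q m)) (restrict R (block Q m))) (leaders Q))
                        ≈ blockProduct ψ P R
    blockProduct-restrict = begin
        ∏ (map (λ m → blockProduct ψ (restrict P (block Q m)) (restrict R (block Q m))) (leaders Q))
      ≈⟨ Prod.fold-cong _ _ (leaders Q) (λ m _ → blockProduct-restrict-block m) ⟩
        ∏ (map (λ m → ∏ (map w (block Q m))) (leaders Q))
      ≈⟨ ∏-regroup Q canQ w ⟩
        ∏ (map w (upTo (length Q)))
      ≈⟨ ≡⇒≈ (cong (λ n → ∏ (map w (upTo n))) eqQR) ⟩
        ∏ (map w (upTo (length R)))
      ≈⟨ Prod.fold-filterᵇ (λ i → app K ψ (restrict P (block R i))) (λ i → at R i ≡ᵇ i) (upTo (length R)) ⟨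
        ∏ (map (λ i → app K ψ (restrict P (block R i))) (leaders R))
      ≈⟨ Prod.fold-map-∘ (λ σ → app K ψ (restrict P σ)) (block R) (leaders R) ⟨
        blockProduct ψ P R
      ∎

  -- R ↦ (R restricted to the blocks of Q) is a bijection, with inverse given by gluing.
  ∑-between-reindex : ∀ P Q → IsNCP P → Q ∈ coarsenings P → (g : List (List ℕ) → Carrier) →
    ∑ (map (λ R → g (map (λ m → restrict R (block Q m)) (leaders Q))) (between P Q))
    ≈ ∑ (map g (cartesian (map (λ m → coarsenings (restrict P (block Q m))) (leaders Q))))
  ∑-between-reindex P Q ncpP Q∈ g = Sum.fold-reindex g restrictions (between P Q) (cartesian (map L ms))
    (between-unique P Q) (cartesian-unique (map L ms) (All-map-unique ms)) injective into onto
    where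
    ms = leaders Q
    L = λ m → coarsenings (restrict P (block Q m))
    restrictions = λ R → map (λ m → restrict R (block Q m)) ms
    leaders-unique = filterᵇ-unique (λ m → at Q m ≡ᵇ m) (Unique.upTo⁺ (length Q))
    All-map-unique : ∀ ks → All Unique (map L ks)
    All-map-unique []       = []
    All-map-unique (k ∷ ks) = coarsenings-unique (restrict P (block Q k)) ∷ All-map-unique ks
    injective : ∀ R R′ → R ∈ between P Q → R′ ∈ between P Q → restrictions R ≡ restrictions R′ → R ≡ R′
    injective R R′ R∈ R′∈ e = restrict-between-injective P Q R R′ Q∈ R∈ R′∈ (map-≡⇒pointwise _ _ ms e)
    into : ∀ R → R ∈ between P Q → restrictions R ∈ cartesian (map L ms)
    into R R∈ = ∈-cartesian⁺ (Pointwise-∈-map _ L ms (λ m m∈ → restrict-∈-coarsenings P Q R m Q∈ R∈ m∈))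
    onto : ∀ t → t ∈ cartesian (map L ms) → Σ (List ℕ) λ R → R ∈ between P Q × restrictions R ≡ t
    onto t t∈ = glued , glued-∈-between ,
                trans (map-cong-local (All.tabulate (λ {m} m∈ → restrict-glued m m∈)))
                      (map-select [] L ms t leaders-unique t∈L)
      where
      t∈L = ∈-cartesian⁻ t (map L ms) t∈
      open Gluing P Q (select [] ms t) ncpP Q∈ (select-∈ [] L ms t leaders-unique t∈L)

  blockProduct-✶ : ∀ P Q → IsNCP P → Q ∈ coarsenings P → (φ ψ : Char) →
    blockProduct (φ ✶ ψ) P Q ≈ ∑ (map (λ R → blockProduct φ R Q * blockProduct ψ P R) (between P Q))
  blockProduct-✶ P Q ncpP Q∈ φ ψ = begin
      ∏ (map (λ τ → app K (φ ✶ ψ) (restrict P τ)) (map (block Q) ms))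
    ≈⟨ Prod.fold-map-∘ _ (block Q) ms ⟩
      ∏ (map (λ m → app K (φ ✶ ψ) (restrict P (block Q m))) ms)
    ≈⟨ Prod.fold-cong _ _ ms (λ m m∈ → ≡⇒≈ (app-valid (φ ✶ ψ) (restrict P (block Q m))
         (IsNCP⇒valid (restrict P (block Q m)) (restrict-block-IsNCP P Q m ncpP eqQ m∈)))) ⟩
      ∏ (map (λ m → ∑ (map (G m) (L m))) ms)
    ≈⟨ ∏-∑-expand ms L G ⟩
      ∑ (map (λ t → ∏ (zipWith G ms t)) (cartesian (map L ms)))
    ≈⟨ ∑-between-reindex P Q ncpP Q∈ (λ t → ∏ (zipWith G ms t)) ⟨
      ∑ (map (λ R → ∏ (zipWith G ms (map (λ m → restrict R (block Q m)) ms))) (between P Q))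
    ≈⟨ Sum.fold-cong _ _ (between P Q) (λ R R∈ →
         ≈-trans (≡⇒≈ (cong ∏ (zipWith-map G (λ m → restrict R (block Q m)) ms)))
           (≈-trans (Prod.fold-distrib _ _ ms)
             (*-cong (≈-sym (Prod.fold-map-∘ (λ τ → app K φ (restrict R τ)) (block Q) ms))
                     (blockProduct-restrict P Q R Q∈ R∈ ψ)))) ⟩
      ∑ (map (λ R → blockProduct φ R Q * blockProduct ψ P R) (between P Q))
    ∎
    where
    ms = leaders Q
    eqQ = proj₁ (∈-coarsenings⁻ P Q Q∈)
    L = λ m → coarsenings (restrict P (block Q m))
    G : ℕ → List ℕ → Carrier
    G m T = summand φ ψ (restrict P (block Q m)) T

  ∑-between : ∀ P Q (f : List ℕ → Carrier) →
    ∑ (map (λ R → if coarser Q R then f R else 0#) (coarsenings P))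
    ≈ (if coarser Q P then ∑ (map f (between P Q)) else 0#)
  ∑-between P Q f with coarser Q P in e
  ... | true  = ≈-sym (Sum.fold-filterᵇ f (λ R → coarser Q R) (coarsenings P))
  ... | false = ≈-trans (≈-sym (Sum.fold-filterᵇ f (λ R → coarser Q R) (coarsenings P)))
                        (Sum.fold-ε f (between P Q) (λ R R∈ → ⊥-elim (Q≱P R R∈)))
    where
    Q≱P : ∀ R → R ∈ between P Q → ⊥
    Q≱P R R∈ with ∈-between⁻ P Q R R∈
    ... | R∈′ , Q≥R with ∈-coarsenings⁻ P R R∈′
    ... | eqR , _ , R≥P = true≢false (trans (sym (Coarser⇒coarser Q P (Coarser-trans Q R P eqR Q≥R R≥P))) e)

  ✶-assoc : ∀ (χ φ ψ : Char) → (χ ✶ (φ ✶ ψ)) ≋ ((χ ✶ φ) ✶ ψ)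
  ✶-assoc χ φ ψ (P , v) = begin
      convolution χ (φ ✶ ψ) P
    ≈⟨ Sum.fold-cong _ _ (coarsenings P) (λ Q Q∈ →
         ≈-trans (*-congˡ (blockProduct-✶ P Q ncpP Q∈ φ ψ)) (*-distribˡ-∑ (app K χ Q) _ (between P Q))) ⟩
      ∑ (map (λ Q → ∑ (map (X Q) (between P Q))) (coarsenings P))
    ≈⟨ Sum.fold-filterᵇ _ (λ Q → coarser Q P) N ⟩
      ∑ (map (λ Q → if coarser Q P then ∑ (map (X Q) (between P Q)) else 0#) N)
    ≈⟨ Sum.fold-cong _ _ N (λ Q _ → ∑-between P Q (X Q)) ⟨
      ∑ (map (λ Q → ∑ (map (λ R → X? Q R) (coarsenings P))) N)
    ≈⟨ Sum.fold-comm (λ R Q → X? Q R) (coarsenings P) N ⟨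
      ∑ (map (λ R → ∑ (map (λ Q → X? Q R) N)) (coarsenings P))
    ≈⟨ Sum.fold-cong _ _ (coarsenings P) (λ R R∈ → ≈-sym (inner R R∈)) ⟩
      convolution (χ ✶ φ) ψ P
    ∎
    where
    ncpP = valid⇒IsNCP P v
    N = ncpList (length P)
    X X? : List ℕ → List ℕ → Carrier
    X Q R = app K χ Q * (blockProduct φ R Q * blockProduct ψ P R)
    X? Q R = if coarser Q R then X Q R else 0#
    inner : ∀ R → R ∈ coarsenings P → summand (χ ✶ φ) ψ P R ≈ ∑ (map (λ Q → X? Q R) N)
    inner R R∈ with ∈-coarsenings⁻ P R R∈
    ... | eqR , vR , _ = begin
        app K (χ ✶ φ) R * blockProduct ψ P R
      ≈⟨ *-congʳ (≡⇒≈ (app-valid (χ ✶ φ) R vR)) ⟩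
        convolution χ φ R * blockProduct ψ P R
      ≈⟨ *-distribʳ-∑ (blockProduct ψ P R) _ (coarsenings R) ⟩
        ∑ (map (λ Q → (app K χ Q * blockProduct φ R Q) * blockProduct ψ P R) (coarsenings R))
      ≈⟨ Sum.fold-cong _ _ (coarsenings R) (λ Q _ → *-assoc _ _ _) ⟩
        ∑ (map (λ Q → X Q R) (filterᵇ (λ Q → coarser Q R) (ncpList (length R))))
      ≈⟨ ≡⇒≈ (cong (λ n → ∑ (map (λ Q → X Q R) (filterᵇ (λ Q → coarser Q R) (ncpList n)))) eqR) ⟩
        ∑ (map (λ Q → X Q R) (filterᵇ (λ Q → coarser Q R) N))
      ≈⟨ Sum.fold-filterᵇ (λ Q → X Q R) (λ Q → coarser Q R) N ⟩
        ∑ (map (λ Q → X? Q R) N)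
      ∎

  -- The recursion on the length of P is run with fuel; any fuel ≥ length P gives the same value.
  module RightInverse (φ : Char) (inv : ℕ → Carrier) (inv-correct : ∀ m → φ (I (suc m) , valid-I m) * inv m ≈ 1#) where

    rest : Char → List ℕ → Carrier
    rest ψ P = ∑ (map (λ Q → if oneBlock Q then 0# else summand φ ψ P Q) (coarsenings P))

    ψ-fuel : ℕ → Char
    ψ-fuel zero    _       = 0#
    ψ-fuel (suc k) (P , v) = inv (pred (length P)) * (ε (P , v) - rest (ψ-fuel k) P)

    ψ : Char
    ψ (P , v) = ψ-fuel (length P) (P , v)

    rest-cong : ∀ {ψ ψ′} P → (∀ l → length l < length P → app K ψ l ≈ app K ψ′ l) → rest ψ P ≈ rest ψ′ P
    rest-cong {ψ} {ψ′} P h = Sum.fold-cong _ _ (coarsenings P) same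
      where
      same : ∀ Q → Q ∈ coarsenings P → (if oneBlock Q then 0# else summand φ ψ P Q)
                                        ≈ (if oneBlock Q then 0# else summand φ ψ′ P Q)
      same Q Q∈ with oneBlock Q in e
      ... | true  = ≈-refl
      ... | false = *-congˡ (Prod.fold-cong _ _ (blocks Q) λ τ τ∈ →
                      h (restrict P τ) (subst (_< length P) (sym (length-restrict P τ)) (block-shorter P Q τ Q∈ e τ∈)))

    ψ-fuel-stable : ∀ a b P (v : T (valid P)) → length P ≤ a → length P ≤ b → ψ-fuel a (P , v) ≈ ψ-fuel b (P , v)
    app-ψ-fuel-stable : ∀ a b l → length l ≤ a → length l ≤ b → app K (ψ-fuel a) l ≈ app K (ψ-fuel b) l

    ψ-fuel-stable zero    _       (_ ∷ _) _ () _
    ψ-fuel-stable (suc a) zero    (_ ∷ _) _ _  ()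
    ψ-fuel-stable (suc a) (suc b) P       v P≤a P≤b = *-congˡ (+-congˡ (-‿cong (rest-cong P λ l l< →
      app-ψ-fuel-stable a b l (m<1+n⇒m≤n (<-≤-trans l< P≤a)) (m<1+n⇒m≤n (<-≤-trans l< P≤b)))))

    app-ψ-fuel-stable a b l l≤a l≤b with T? (valid l)
    ... | yes v = ψ-fuel-stable a b l v l≤a l≤b
    ... | no _  = ≈-refl

    app-ψ≈app-ψ-fuel : ∀ k l → length l ≤ k → app K ψ l ≈ app K (ψ-fuel k) l
    app-ψ≈app-ψ-fuel k l l≤k with T? (valid l)
    ... | yes v = ψ-fuel-stable (length l) k l v ≤-refl l≤k
    ... | no _  = ≈-refl

    ✶-inverseʳ : (φ ✶ ψ) ≋ ε
    ✶-inverseʳ (x ∷ xs , v) = begin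
        convolution φ ψ P
      ≈⟨ ∑-coarsenings-split (summand φ ψ P) P (valid⇒IsNCP P v) ⟩
        summand φ ψ P (I n) + rest ψ P
      ≈⟨ +-cong (summand-I φ ψ P m v refl) (rest-cong P (λ l l< → app-ψ≈app-ψ-fuel m l (m<1+n⇒m≤n l<))) ⟩
        φ (I n , valid-I m) * (inv m * (εP - rest (ψ-fuel m) P)) + rest (ψ-fuel m) P
      ≈⟨ +-congʳ (≈-trans (≈-sym (*-assoc _ _ _)) (≈-trans (*-congʳ (inv-correct m)) (*-identityˡ _))) ⟩
        (εP - rest (ψ-fuel m) P) + rest (ψ-fuel m) P
      ≈⟨ ≈-trans (+-assoc _ _ _) (≈-trans (+-congˡ (-‿inverseˡ _)) (+-identityʳ _)) ⟩
        εP
      ∎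
      where
      P = x ∷ xs
      m = length xs
      n = suc m
      εP = ε (P , v)

  I-value : ∀ (χ : Char) n (p : T (valid (I (suc n)))) → χ (I (suc n) , p) ≡ χ (I (suc n) , valid-I n)
  I-value χ n p = cong (λ w → χ (I (suc n) , w)) (T-irrelevant p (valid-I n))

  ✶-inverse-I : ∀ (χ ψ : Char) → (χ ✶ ψ) ≋ ε → ∀ n →
                χ (I (suc n) , valid-I n) * ψ (I (suc n) , valid-I n) ≈ 1#
  ✶-inverse-I χ ψ h n = ≈-trans (≈-sym (✶-I χ ψ n)) (≈-trans (h (I (suc n) , valid-I n))
                          (≡⇒≈ (cong (λ b → if b then 1# else 0#) (oneBlock-I (suc n)))))

  NonzeroOnI : Char → Set ℓ
  NonzeroOnI χ = ∀ n (p : T (valid (I (suc n)))) → ¬ (χ (I (suc n) , p) ≈ 0#)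

  module _ (field′ : IsField K) where

    private
      nontrivial : ¬ (0# ≈ 1#)
      nontrivial = proj₁ field′

    *-≈1⇒nonzeroˡ : ∀ {x y} → x * y ≈ 1# → ¬ (x ≈ 0#)
    *-≈1⇒nonzeroˡ xy≈1 x≈0 = nontrivial (≈-trans (≈-sym (≈-trans (*-congʳ x≈0) (zeroˡ _))) xy≈1)

    *-≈1⇒nonzeroʳ : ∀ {x y} → x * y ≈ 1# → ¬ (y ≈ 0#)
    *-≈1⇒nonzeroʳ xy≈1 y≈0 = nontrivial (≈-trans (≈-sym (≈-trans (*-congˡ y≈0) (zeroʳ _))) xy≈1)

    right-invertible : ∀ (χ : Char) → NonzeroOnI χ → Σ Char λ ψ → (χ ✶ ψ) ≋ ε
    right-invertible χ nz = ψ , ✶-inverseʳ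
      where
      inverse-at-I = λ n → proj₂ field′ (χ (I (suc n) , valid-I n)) (nz n (valid-I n))
      open RightInverse χ (λ n → proj₁ (inverse-at-I n)) (λ n → proj₂ (inverse-at-I n))

    right-inverse-nonzero : ∀ (χ ψ : Char) → (χ ✶ ψ) ≋ ε → NonzeroOnI ψ
    right-inverse-nonzero χ ψ h n p ψ≈0 = *-≈1⇒nonzeroʳ (✶-inverse-I χ ψ h n) (≈-trans (≡⇒≈ (sym (I-value ψ n p))) ψ≈0)

    invertible⇒nonzero : ∀ (φ : Char) → Invertible K φ → NonzeroOnI φ
    invertible⇒nonzero φ (ψ , φψ≈ε , _) n p φ≈0 =
      *-≈1⇒nonzeroˡ (✶-inverse-I φ ψ φψ≈ε n) (≈-trans (≡⇒≈ (sym (I-value φ n p))) φ≈0)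

    nonzero⇒invertible : ∀ (φ : Char) → NonzeroOnI φ → Invertible K φ
    nonzero⇒invertible φ nz = ψ , φψ≈ε , ψφ≈ε
      where
      ψ-inv = right-invertible φ nz
      ψ = proj₁ ψ-inv
      φψ≈ε = proj₂ ψ-inv
      ω-inv = right-invertible ψ (right-inverse-nonzero φ ψ φψ≈ε)
      ω = proj₁ ω-inv
      φ≈ω : φ ≋ ω
      φ≈ω P = begin
          φ P              ≈⟨ ✶-identityʳ φ P ⟨
          (φ ✶ ε) P        ≈⟨ ✶-cong (λ _ → ≈-refl) (λ Q → ≈-sym (proj₂ ω-inv Q)) P ⟩
          (φ ✶ (ψ ✶ ω)) P  ≈⟨ ✶-assoc φ ψ ω P ⟩
          ((φ ✶ ψ) ✶ ω) P  ≈⟨ ✶-cong φψ≈ε (λ _ → ≈-refl) P ⟩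
          (ε ✶ ω) P        ≈⟨ ✶-identityˡ ω P ⟩
          ω P              ∎
      ψφ≈ε : (ψ ✶ φ) ≋ ε
      ψφ≈ε P = ≈-trans (✶-cong (λ _ → ≈-refl) φ≈ω P) (proj₂ ω-inv P)

mainTheorem19 : ∀ {c ℓ : Level} (K : CommutativeRing c ℓ) → IsField K → CharZero K →
  (φ : Character K) →
  Invertible K φ ⇔
    (∀ (n : ℕ) (p : T (valid (I (suc n)))) →
      ¬ (CommutativeRing._≈_ K (φ (I (suc n) , p)) (CommutativeRing.0# K)))
mainTheorem19 K field′ _ φ = mk⇔ (invertible⇒nonzero field′ φ) (nonzero⇒invertible field′ φ)
  where open Characters K
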